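{- Let $1\le n\le 84$. Then $nK_2$ admits a $2$-super graceful labeling whose edge-label set is $[2,n+1]$ if and only if $n\equiv 0,3\pmod 4$.
   Context: $nK_2$ denotes the disjoint union of $n$ copies of $K_2$. For integers $a\le b$, $[a,b]$ is the set of integers between $a$ and $b$ inclusive. For $k\ge 1$, a $k$-super graceful labeling of a graph $G=(V,E)$ with $p$ vertices and $q$ edges is a bijection $f:V\cup E\to[k,k+p+q-1]$ with $f(uv)=|f(u)-f(v)|$ for every edge $uv$. -}

module Defs where

open import Data.Nat using (ℕ; suc; _+_; _*_; _∸_; _≤_)
open import Data.Nat.Properties using ()
open import Data.Fin using (Fin; toℕ; combine; _↑ˡ_; _↑ʳ_)
open import Data.Product using (_×_; _,_; Σ; ∃; proj₁; proj₂)
open import Data.Sum using (_⊎_; inj₁; inj₂; [_,_])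
open import Function.Definitions using (Injective)
open import Relation.Binary.PropositionalEquality using (_≡_)

∣_-_∣ : ℕ → ℕ → ℕ
∣ a - b ∣ = (a ∸ b) + (b ∸ a)

record Graph : Set where
  field
    p : ℕ
    q : ℕ
    ends : Fin q → Fin p × Fin p
open Graph public

InRange : ℕ → ℕ → ℕ → Set
InRange a b x = a ≤ x × x ≤ b

record SuperGraceful (k : ℕ) (G : Graph) : Set where
  field
    lab : Fin (p G) ⊎ Fin (q G) → ℕ
    injective : Injective _≡_ _≡_ lab
    inRange : ∀ x → InRange k (k + p G + q G ∸ 1) (lab x)
    onto : ∀ y → InRange k (k + p G + q G ∸ 1) y → ∃ λ x → lab x ≡ y
    edgeCond : ∀ (e : Fin (q G)) →
      lab (inj₂ e) ≡ ∣ lab (inj₁ (proj₁ (ends G e))) - lab (inj₁ (proj₂ (ends G e))) ∣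
open SuperGraceful public

EdgeLabelSet : ∀ {k G} → SuperGraceful k G → ℕ → ℕ → Set
EdgeLabelSet {k} {G} L a b =
  (∀ (e : Fin (q G)) → InRange a b (lab L (inj₂ e))) ×
  (∀ y → InRange a b y → ∃ λ (e : Fin (q G)) → lab L (inj₂ e) ≡ y)

nK₂ : ℕ → Graph
nK₂ n = record
  { p = n + n
  ; q = n
  ; ends = λ i → (i ↑ˡ n) , (n ↑ʳ i)
  }

module Submission where

-- Necessity is a parity argument valid for every n and every k.  The labels of a
-- k-super graceful labelling form an interval, so they add up to k + (k+1) + ⋯ + (k+3n-1);
-- on the other hand each copy uv of K₂ contributes u + v + |u - v| = 2·max(u, v), so the
-- total is even.  For n ≢ 0, 3 (mod 4) that interval sum (with k = 2) is odd.
--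
-- Sufficiency goes through Langford pairings: a partition of {0, …, 2n-1} into pairs
-- {aᵢ, aᵢ + d + i}, i < n, yields a d-super graceful labelling of nK₂ with edge labels
-- [d, d+n-1] (edge i gets d + i, the vertex in slot j gets d + n + j).  For each admissible
-- n ≤ 84 a Langford pairing of defect 2 is tabulated together with its inverse, and a
-- boolean checker, proved sound, validates the table by evaluation.  The same evaluation
-- confirms that the interval sum is odd for the remaining n ≤ 84.

open import Defs
open import Data.Bool using (Bool; true; false; T; not; _∧_)
open import Data.Bool.Properties using (T-∧; T-not-≡)
open import Data.Empty using (⊥-elim)
open import Data.Unit using (tt)
open import Data.Fin using (Fin; zero; suc; toℕ; fromℕ<; splitAt; join; _↑ˡ_; _↑ʳ_)
open import Data.Fin.Permutation using (permutation)
open import Data.Fin.Properties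
  using (toℕ-injective; toℕ-fromℕ<; toℕ<n; splitAt-↑ˡ; splitAt-↑ʳ; splitAt-join; join-splitAt)
open import Data.List using (List; []; _∷_; head; drop)
open import Data.Maybe using (fromMaybe)
open import Data.Nat
  using (ℕ; zero; suc; _+_; _*_; _∸_; _⊔_; _%_; _≤_; _<_; _<ᵇ_; _≡ᵇ_; _<?_; z≤n; s≤s; >-nonZero)
open import Data.Nat.Properties
open import Data.Nat.DivMod using (m*n%n≡0)
open import Data.Product using (Σ; ∃; _×_; _,_; proj₁; proj₂; map₂)
open import Data.Sum using (_⊎_; inj₁; inj₂; [_,_])
open import Data.Vec.Functional using (_++_)
open import Function using (_∘_; _⇔_; mk⇔; Equivalence)
open import Function.Definitions using (Injective)
open import Relation.Binary.PropositionalEquality hiding ([_])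
open import Relation.Nullary using (Dec; yes; no; contradiction)
open import Relation.Nullary.Decidable using (_⊎-dec_)
open import Algebra.Properties.Semiring.Sum +-*-semiring
  using (sum; sum-cong-≗; sum-permute; ∑-distrib-+; *-distribʳ-sum)

open Equivalence using (to)

-- Finite sums and intervals

consecutiveSum : ℕ → ℕ → ℕ
consecutiveSum k m = sum (λ (i : Fin m) → k + toℕ i)

sum-split : ∀ m {n} (f : Fin (m + n) → ℕ) →
            sum f ≡ sum (f ∘ (_↑ˡ n)) + sum (f ∘ (m ↑ʳ_))
sum-split zero    f = refl
sum-split (suc m) f =
  trans (cong (f zero +_) (sum-split m (f ∘ suc))) (sym (+-assoc (f zero) _ _))

offset-inRange : ∀ k {m j} → j < m → InRange k (k + m ∸ 1) (k + j)
offset-inRange k j<m = m≤m+n k _ , <⇒≤pred (+-monoʳ-< k j<m)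

inRange⇒offset : ∀ {k m y} → 0 < k + m → InRange k (k + m ∸ 1) y →
                 ∃ λ (j : Fin m) → k + toℕ j ≡ y
inRange⇒offset {k} {m} {y} k+m>0 (k≤y , y≤top) =
  fromℕ< y∸k<m , trans (cong (k +_) (toℕ-fromℕ< y∸k<m)) (m+[n∸m]≡n k≤y)
  where
  y∸k<m : y ∸ k < m
  y∸k<m = subst (y ∸ k <_) (m+n∸m≡n k m)
            (∸-monoˡ-< (m≤pred[n]⇒suc[m]≤n {{>-nonZero k+m>0}} y≤top) k≤y)

-- A bijection from Fin m onto [k, k+m-1] is a permutation of that interval, so its
-- values add up to the interval sum.
sum-of-interval-bijection :
  ∀ k {m} (g : Fin m → ℕ) → Injective _≡_ _≡_ g →
  (∀ x → InRange k (k + m ∸ 1) (g x)) →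
  (∀ y → InRange k (k + m ∸ 1) y → ∃ λ x → g x ≡ y) →
  sum g ≡ consecutiveSum k m
sum-of-interval-bijection k {m} g g-injective g-inRange g-onto =
  trans (sum-cong-≗ (sym ∘ index-correct)) (sym (sum-permute (λ i → k + toℕ i) π))
  where
  positive : Fin m → 0 < k + m
  positive x = <-≤-trans (≤-<-trans z≤n (toℕ<n x)) (m≤n+m m k)

  index : Fin m → Fin m
  index x = proj₁ (inRange⇒offset (positive x) (g-inRange x))

  index-correct : ∀ x → k + toℕ (index x) ≡ g x
  index-correct x = proj₂ (inRange⇒offset (positive x) (g-inRange x))

  filler : Fin m → Fin m
  filler j = proj₁ (g-onto (k + toℕ j) (offset-inRange k (toℕ<n j)))

  index∘filler : ∀ j → index (filler j) ≡ j
  index∘filler j = toℕ-injective (+-cancelˡ-≡ k _ _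
    (trans (index-correct (filler j)) (proj₂ (g-onto (k + toℕ j) _))))

  filler∘index : ∀ x → filler (index x) ≡ x
  filler∘index x = g-injective (trans (proj₂ (g-onto _ _)) (index-correct x))

  π = permutation index filler index∘filler filler∘index

-- Necessity: the parity of the label sum

labelVector : ∀ {k G} → SuperGraceful k G → Fin (p G + q G) → ℕ
labelVector {G = G} L = lab L ∘ splitAt (p G)

labelSum : ∀ {k G} (L : SuperGraceful k G) →
           sum (labelVector L) ≡ consecutiveSum k (p G + q G)
labelSum {k} {G} L = sum-of-interval-bijection k (labelVector L) injective′ inRange′ onto′
  where
  reassoc : k + p G + q G ≡ k + (p G + q G)
  reassoc = +-assoc k (p G) (q G)

  injective′ : Injective _≡_ _≡_ (labelVector L)
  injective′ {x} {y} eq = trans (sym (join-splitAt (p G) (q G) x))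
    (trans (cong (join (p G) (q G)) (injective L eq)) (join-splitAt (p G) (q G) y))

  inRange′ : ∀ x → InRange k (k + (p G + q G) ∸ 1) (labelVector L x)
  inRange′ x = subst (λ top → InRange k (top ∸ 1) (labelVector L x)) reassoc (inRange L _)

  onto′ : ∀ y → InRange k (k + (p G + q G) ∸ 1) y → ∃ λ x → labelVector L x ≡ y
  onto′ y y∈ with onto L y (subst (λ top → InRange k (top ∸ 1) y) (sym reassoc) y∈)
  ... | w , lw≡y = join (p G) (q G) w , trans (cong (lab L) (splitAt-join (p G) (q G) w)) lw≡y

-- x + x = 2x, in the orientation used by the distance formula below.
double : ∀ x → x + x ≡ x * 2
double x = sym (trans (*-comm x 2) (cong (x +_) (+-identityʳ x)))

sum+dist≡2max : ∀ a b → a + b + ∣ a - b ∣ ≡ (a ⊔ b) * 2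
sum+dist≡2max zero    zero    = refl
sum+dist≡2max zero    (suc b) = double (suc b)
sum+dist≡2max (suc a) zero    =
  trans (cong₂ _+_ (+-identityʳ (suc a)) (+-identityʳ (suc a))) (double (suc a))
sum+dist≡2max (suc a) (suc b) =
  cong suc (trans (cong (_+ ∣ a - b ∣) (+-suc a b)) (cong suc (sum+dist≡2max a b)))

leftLabel rightLabel : ∀ {k n} → SuperGraceful k (nK₂ n) → Fin n → ℕ
leftLabel  {n = n} L e = lab L (inj₁ (e ↑ˡ n))
rightLabel {n = n} L e = lab L (inj₁ (n ↑ʳ e))

-- In nK₂ every vertex lies on exactly one edge, so the label sum is
-- ∑ₑ (u + v + |u - v|) = 2 ∑ₑ max(u, v).
labelSum-nK₂ : ∀ {k n} (L : SuperGraceful k (nK₂ n)) →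
               sum (labelVector L) ≡ sum (λ e → leftLabel L e ⊔ rightLabel L e) * 2
labelSum-nK₂ {n = n} L = begin
  sum (labelVector L)
    ≡⟨ sum-split (n + n) (labelVector L) ⟩
  sum (labelVector L ∘ (_↑ˡ n)) + sum (labelVector L ∘ ((n + n) ↑ʳ_))
    ≡⟨ cong₂ _+_ (sum-cong-≗ (cong (lab L) ∘ λ v → splitAt-↑ˡ (n + n) v n))
                 (sum-cong-≗ (cong (lab L) ∘ splitAt-↑ʳ (n + n) n)) ⟩
  sum vertex + sum edge
    ≡⟨ cong (_+ sum edge) (sum-split n vertex) ⟩
  sum u + sum w + sum edge
    ≡⟨ cong (_+ sum edge) (∑-distrib-+ u w) ⟨
  sum (λ e → u e + w e) + sum edge
    ≡⟨ ∑-distrib-+ (λ e → u e + w e) edge ⟨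
  sum (λ e → u e + w e + edge e)
    ≡⟨ sum-cong-≗ (λ e → trans (cong (u e + w e +_) (edgeCond L e)) (sum+dist≡2max (u e) (w e))) ⟩
  sum (λ e → (u e ⊔ w e) * 2)
    ≡⟨ *-distribʳ-sum 2 (λ e → u e ⊔ w e) ⟨
  sum (λ e → u e ⊔ w e) * 2 ∎
  where
  open ≡-Reasoning
  vertex : Fin (n + n) → ℕ
  vertex = lab L ∘ inj₁
  edge u w : Fin n → ℕ
  edge = lab L ∘ inj₂
  u = leftLabel L
  w = rightLabel L

nK₂-parity : ∀ {k n} → SuperGraceful k (nK₂ n) → consecutiveSum k (n + n + n) % 2 ≡ 0
nK₂-parity L = trans (cong (_% 2) (trans (sym (labelSum L)) (labelSum-nK₂ L)))
                     (m*n%n≡0 (sum (λ e → leftLabel L e ⊔ rightLabel L e)) 2)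

-- Sufficiency: Langford pairings

-- The 2n slots used by n pairs, where pair i sits at first i and first i + (d + i).
-- Slots are indexed like the vertices of nK₂: left endpoints, then right endpoints.
pairPositions : ∀ d {n} → (Fin n → ℕ) → Fin (n + n) → ℕ
pairPositions d first = first ++ (λ i → first i + (d + toℕ i))

record LangfordPairing (d n : ℕ) : Set where
  field
    first    : Fin n → ℕ
    below    : ∀ v → pairPositions d first v < n + n
    distinct : Injective _≡_ _≡_ (pairPositions d first)
    covering : ∀ j → j < n + n → ∃ λ v → pairPositions d first v ≡ j

dist-+ : ∀ a b → ∣ a - a + b ∣ ≡ b
dist-+ a b = cong₂ _+_ (m≤n⇒m∸n≡0 (m≤m+n a b)) (m+n∸m≡n a b)

-- The labelling induced by a Langford pairing of defect d ≥ 1: edge i is labelled d + i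
-- and the vertex in slot j is labelled d + n + j, so the two ends of edge i differ by
-- exactly d + i.
module LangfordLabelling {d n : ℕ} (1≤d : 1 ≤ d) (P : LangfordPairing d n) where
  open LangfordPairing P

  slot : Fin (n + n) → ℕ
  slot = pairPositions d first

  -- labels are d + offset, and the offsets are a bijection onto [0, 3n)
  offset : Fin (n + n) ⊎ Fin n → ℕ
  offset (inj₁ v) = n + slot v
  offset (inj₂ e) = toℕ e

  offset-< : ∀ x → offset x < n + n + n
  offset-< (inj₁ v) = subst (n + slot v <_) (+-comm n (n + n)) (+-monoʳ-< n (below v))
  offset-< (inj₂ e) = <-≤-trans (toℕ<n e) (m≤n+m n (n + n))

  edge<vertex : ∀ e v → toℕ e < n + slot v
  edge<vertex e v = <-≤-trans (toℕ<n e) (m≤m+n n (slot v))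

  offset-injective : Injective _≡_ _≡_ offset
  offset-injective {inj₁ u} {inj₁ v} eq = cong inj₁ (distinct (+-cancelˡ-≡ n _ _ eq))
  offset-injective {inj₁ u} {inj₂ e} eq = contradiction (sym eq) (<⇒≢ (edge<vertex e u))
  offset-injective {inj₂ e} {inj₁ v} eq = contradiction eq (<⇒≢ (edge<vertex e v))
  offset-injective {inj₂ e} {inj₂ f} eq = cong inj₂ (toℕ-injective eq)

  vertex-slot< : ∀ {j} → n ≤ j → j < n + n + n → j ∸ n < n + n
  vertex-slot< {j} n≤j j<3n = subst (j ∸ n <_) (m+n∸m≡n n (n + n))
    (∸-monoˡ-< (subst (j <_) (+-comm (n + n) n) j<3n) n≤j)

  offset-onto : ∀ (j : Fin (n + n + n)) → ∃ λ x → offset x ≡ toℕ j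
  offset-onto j with toℕ j <? n
  ... | yes j<n = inj₂ (fromℕ< j<n) , toℕ-fromℕ< j<n
  ... | no j≮n with covering (toℕ j ∸ n) (vertex-slot< (≮⇒≥ j≮n) (toℕ<n j))
  ...   | v , slot≡ = inj₁ v , trans (cong (n +_) slot≡) (m+[n∸m]≡n (≮⇒≥ j≮n))

  label : Fin (n + n) ⊎ Fin n → ℕ
  label x = d + offset x

  positive : ∀ m → 0 < d + m
  positive m = ≤-trans 1≤d (m≤m+n d m)

  reassoc : d + (n + n) + n ≡ d + (n + n + n)
  reassoc = +-assoc d (n + n) n

  label-inRange : ∀ x → InRange d (d + (n + n) + n ∸ 1) (label x)
  label-inRange x = subst (λ top → InRange d (top ∸ 1) (label x)) (sym reassoc)
                          (offset-inRange d (offset-< x))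

  label-onto : ∀ y → InRange d (d + (n + n) + n ∸ 1) y → ∃ λ x → label x ≡ y
  label-onto y y∈ with inRange⇒offset (positive (n + n + n))
                         (subst (λ top → InRange d (top ∸ 1) y) reassoc y∈)
  ... | j , d+j≡y with offset-onto j
  ...   | x , offset≡ = x , trans (cong (d +_) offset≡) d+j≡y

  left-slot : ∀ e → slot (e ↑ˡ n) ≡ first e
  left-slot e = cong [ first , (λ i → first i + (d + toℕ i)) ] (splitAt-↑ˡ n e n)

  right-slot : ∀ e → slot (n ↑ʳ e) ≡ first e + (d + toℕ e)
  right-slot e = cong [ first , (λ i → first i + (d + toℕ i)) ] (splitAt-↑ʳ n n e)

  label-edge : ∀ e → label (inj₂ e) ≡ ∣ label (inj₁ (e ↑ˡ n)) - label (inj₁ (n ↑ʳ e)) ∣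
  label-edge e = sym (begin
    ∣ d + (n + slot (e ↑ˡ n)) - d + (n + slot (n ↑ʳ e)) ∣
      ≡⟨ cong₂ (λ a b → ∣ d + (n + a) - d + (n + b) ∣) (left-slot e) (right-slot e) ⟩
    ∣ d + (n + a) - d + (n + (a + δ)) ∣
      ≡⟨ cong (λ b → ∣ d + (n + a) - b ∣) (trans (cong (d +_) (sym (+-assoc n a δ)))
                                                  (sym (+-assoc d (n + a) δ))) ⟩
    ∣ d + (n + a) - d + (n + a) + δ ∣
      ≡⟨ dist-+ (d + (n + a)) δ ⟩
    δ ∎)
    where
    open ≡-Reasoning
    a δ : ℕ
    a = first e
    δ = d + toℕ e

  labelling : SuperGraceful d (nK₂ n)
  labelling = record
    { lab = label
    ; injective = offset-injective ∘ +-cancelˡ-≡ d _ _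
    ; inRange = label-inRange
    ; onto = label-onto
    ; edgeCond = label-edge
    }

  edgeLabels : EdgeLabelSet labelling d (d + n ∸ 1)
  edgeLabels = (λ e → offset-inRange d (toℕ<n e))
             , (λ y y∈ → inRange⇒offset (positive n) y∈)

langford⇒superGraceful : ∀ {d n} → 1 ≤ d → LangfordPairing d n →
                         Σ (SuperGraceful d (nK₂ n)) (λ L → EdgeLabelSet L d (d + n ∸ 1))
langford⇒superGraceful 1≤d P = labelling , edgeLabels
  where open LangfordLabelling 1≤d P

-- Checking a tabulated pairing by evaluation

-- Boolean bounded quantifiers, evaluated by the type checker.
allFin : ∀ m → (Fin m → Bool) → Bool
allFin zero    f = true
allFin (suc m) f = f zero ∧ allFin m (f ∘ suc)

allFin-sound : ∀ m (f : Fin m → Bool) → T (allFin m f) → ∀ i → T (f i)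
allFin-sound (suc m) f ok zero    = proj₁ (to T-∧ ok)
allFin-sound (suc m) f ok (suc i) = allFin-sound m (f ∘ suc) (proj₂ (to T-∧ ok)) i

allBelow : ℕ → (ℕ → Bool) → Bool
allBelow m f = allFin m (f ∘ toℕ)

allBelow-sound : ∀ m (f : ℕ → Bool) → T (allBelow m f) → ∀ j → j < m → T (f j)
allBelow-sound m f ok j j<m =
  subst (T ∘ f) (toℕ-fromℕ< j<m) (allFin-sound m (f ∘ toℕ) ok (fromℕ< j<m))

-- A candidate pairing is given by the first positions and by its inverse table
-- `occupant`, which names the slot (vertex) occupying each position.  The check
-- verifies that occupant is a two-sided inverse of the slot positions.
module _ (d n : ℕ) (first occupant : ℕ → ℕ) where

  position : Fin (n + n) → ℕ
  position = pairPositions d {n} (first ∘ toℕ)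

  placed : Fin (n + n) → Bool
  placed v = (position v <ᵇ n + n) ∧ (occupant (position v) ≡ᵇ toℕ v)

  filled : ℕ → Bool
  filled j with occupant j <? n + n
  ... | yes o<2n = position (fromℕ< o<2n) ≡ᵇ j
  ... | no _     = false

  filled-sound : ∀ j → T (filled j) → ∃ λ v → position v ≡ j
  filled-sound j ok with occupant j <? n + n
  ... | yes o<2n = fromℕ< o<2n , ≡ᵇ⇒≡ _ _ ok

  checkPairing : Bool
  checkPairing = allFin (n + n) placed ∧ allBelow (n + n) filled

  checkPairing-sound : T checkPairing → LangfordPairing d n
  checkPairing-sound ok = record
    { first    = first ∘ toℕ
    ; below    = λ v → <ᵇ⇒< _ _ (proj₁ (to T-∧ (placed-ok v)))
    ; distinct = λ {u} {v} eq → toℕ-injective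
        (trans (sym (recorded u)) (trans (cong occupant eq) (recorded v)))
    ; covering = λ j j<2n → filled-sound j (allBelow-sound (n + n) filled filled-ok j j<2n)
    }
    where
    placed-ok : ∀ v → T (placed v)
    placed-ok = allFin-sound (n + n) placed (proj₁ (to T-∧ ok))
    filled-ok : T (allBelow (n + n) filled)
    filled-ok = proj₂ (to T-∧ ok)
    recorded : ∀ v → occupant (position v) ≡ toℕ v
    recorded v = ≡ᵇ⇒≡ _ _ (proj₂ (to T-∧ (placed-ok v)))

-- The tabulated pairings

entry : {A : Set} → A → List A → ℕ → A
entry default xs n = fromMaybe default (head (drop n xs))

-- Row n lists first positions aᵢ (i < n) of a Langford pairing of defect 2 and order n,
-- for every n ≤ 84 with n ≡ 0, 3 (mod 4); other rows are empty.
firstTable : List (List ℕ)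
firstTable =
  []
  ∷ []
  ∷ []
  ∷ (1 ∷ 2 ∷ 0 ∷ [])
  ∷ (1 ∷ 4 ∷ 2 ∷ 0 ∷ [])
  ∷ []
  ∷ []
  ∷ (1 ∷ 10 ∷ 5 ∷ 6 ∷ 2 ∷ 0 ∷ 4 ∷ [])
  ∷ (0 ∷ 12 ∷ 7 ∷ 5 ∷ 3 ∷ 1 ∷ 6 ∷ 4 ∷ [])
  ∷ []
  ∷ []
  ∷ (13 ∷ 2 ∷ 0 ∷ 11 ∷ 3 ∷ 14 ∷ 12 ∷ 1 ∷ 8 ∷ 6 ∷ 7 ∷ [])
  ∷ (9 ∷ 1 ∷ 16 ∷ 14 ∷ 0 ∷ 3 ∷ 15 ∷ 13 ∷ 2 ∷ 7 ∷ 5 ∷ 8 ∷ [])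
  ∷ []
  ∷ []
  ∷ (25 ∷ 19 ∷ 5 ∷ 2 ∷ 23 ∷ 6 ∷ 4 ∷ 15 ∷ 18 ∷ 10 ∷ 8 ∷ 3 ∷ 0 ∷ 11 ∷ 1 ∷ [])
  ∷ (29 ∷ 23 ∷ 3 ∷ 11 ∷ 6 ∷ 20 ∷ 22 ∷ 0 ∷ 4 ∷ 8 ∷ 13 ∷ 15 ∷ 10 ∷ 2 ∷ 5 ∷ 1 ∷ [])
  ∷ []
  ∷ []
  ∷ (25 ∷ 3 ∷ 9 ∷ 28 ∷ 10 ∷ 1 ∷ 7 ∷ 23 ∷ 2 ∷ 26 ∷ 24 ∷ 17 ∷ 20 ∷ 14 ∷ 5 ∷ 18 ∷ 4 ∷ 0 ∷ 11 ∷ [])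
  ∷ (25 ∷ 2 ∷ 8 ∷ 33 ∷ 7 ∷ 28 ∷ 6 ∷ 22 ∷ 1 ∷ 10 ∷ 24 ∷ 26 ∷ 15 ∷ 3 ∷ 16 ∷ 17 ∷ 19 ∷ 4 ∷ 0 ∷ 9 ∷ [])
  ∷ []
  ∷ []
  ∷ (40 ∷ 5 ∷ 0 ∷ 7 ∷ 13 ∷ 21 ∷ 29 ∷ 35 ∷ 6 ∷ 27 ∷ 2 ∷ 17 ∷ 31 ∷ 26 ∷ 9 ∷ 15 ∷ 18 ∷ 20 ∷ 3 ∷ 22 ∷ 11 ∷ 1 ∷ 10 ∷ [])
  ∷ (2 ∷ 41 ∷ 35 ∷ 29 ∷ 40 ∷ 6 ∷ 0 ∷ 7 ∷ 33 ∷ 17 ∷ 10 ∷ 14 ∷ 24 ∷ 3 ∷ 5 ∷ 19 ∷ 12 ∷ 23 ∷ 11 ∷ 26 ∷ 15 ∷ 9 ∷ 1 ∷ 20 ∷ [])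
  ∷ []
  ∷ []
  ∷ (46 ∷ 1 ∷ 40 ∷ 10 ∷ 37 ∷ 18 ∷ 33 ∷ 13 ∷ 6 ∷ 36 ∷ 26 ∷ 8 ∷ 3 ∷ 9 ∷ 29 ∷ 2 ∷ 35 ∷ 31 ∷ 0 ∷ 30 ∷ 5 ∷ 11 ∷ 28 ∷ 7 ∷ 23 ∷ 12 ∷ 14 ∷ [])
  ∷ (0 ∷ 45 ∷ 11 ∷ 22 ∷ 36 ∷ 47 ∷ 41 ∷ 43 ∷ 8 ∷ 40 ∷ 9 ∷ 10 ∷ 39 ∷ 16 ∷ 1 ∷ 29 ∷ 19 ∷ 5 ∷ 13 ∷ 14 ∷ 4 ∷ 7 ∷ 20 ∷ 25 ∷ 12 ∷ 28 ∷ 6 ∷ 3 ∷ [])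
  ∷ []
  ∷ []
  ∷ (9 ∷ 46 ∷ 54 ∷ 2 ∷ 44 ∷ 8 ∷ 5 ∷ 10 ∷ 24 ∷ 16 ∷ 36 ∷ 47 ∷ 25 ∷ 17 ∷ 6 ∷ 40 ∷ 43 ∷ 37 ∷ 1 ∷ 20 ∷ 33 ∷ 28 ∷ 18 ∷ 4 ∷ 12 ∷ 26 ∷ 31 ∷ 23 ∷ 0 ∷ 14 ∷ 3 ∷ [])
  ∷ (24 ∷ 56 ∷ 23 ∷ 58 ∷ 6 ∷ 8 ∷ 54 ∷ 40 ∷ 47 ∷ 2 ∷ 41 ∷ 35 ∷ 4 ∷ 16 ∷ 1 ∷ 43 ∷ 20 ∷ 33 ∷ 30 ∷ 7 ∷ 22 ∷ 32 ∷ 5 ∷ 0 ∷ 19 ∷ 34 ∷ 9 ∷ 10 ∷ 21 ∷ 11 ∷ 14 ∷ 3 ∷ [])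
  ∷ []
  ∷ []
  ∷ (56 ∷ 12 ∷ 60 ∷ 48 ∷ 63 ∷ 55 ∷ 46 ∷ 59 ∷ 13 ∷ 0 ∷ 49 ∷ 18 ∷ 26 ∷ 19 ∷ 35 ∷ 5 ∷ 20 ∷ 8 ∷ 4 ∷ 45 ∷ 14 ∷ 29 ∷ 1 ∷ 3 ∷ 16 ∷ 30 ∷ 37 ∷ 21 ∷ 17 ∷ 2 ∷ 9 ∷ 6 ∷ 10 ∷ 32 ∷ 7 ∷ [])
  ∷ (67 ∷ 49 ∷ 5 ∷ 63 ∷ 6 ∷ 19 ∷ 51 ∷ 30 ∷ 50 ∷ 0 ∷ 3 ∷ 57 ∷ 18 ∷ 21 ∷ 45 ∷ 8 ∷ 28 ∷ 10 ∷ 4 ∷ 17 ∷ 43 ∷ 31 ∷ 40 ∷ 33 ∷ 1 ∷ 35 ∷ 13 ∷ 42 ∷ 23 ∷ 16 ∷ 34 ∷ 22 ∷ 14 ∷ 2 ∷ 20 ∷ 7 ∷ [])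
  ∷ []
  ∷ []
  ∷ (21 ∷ 66 ∷ 47 ∷ 43 ∷ 13 ∷ 2 ∷ 8 ∷ 58 ∷ 24 ∷ 52 ∷ 10 ∷ 60 ∷ 11 ∷ 12 ∷ 55 ∷ 1 ∷ 14 ∷ 57 ∷ 45 ∷ 54 ∷ 37 ∷ 38 ∷ 7 ∷ 28 ∷ 3 ∷ 41 ∷ 49 ∷ 17 ∷ 44 ∷ 4 ∷ 30 ∷ 6 ∷ 36 ∷ 15 ∷ 20 ∷ 5 ∷ 26 ∷ 33 ∷ 0 ∷ [])
  ∷ (64 ∷ 2 ∷ 57 ∷ 3 ∷ 15 ∷ 10 ∷ 60 ∷ 58 ∷ 9 ∷ 1 ∷ 6 ∷ 7 ∷ 28 ∷ 40 ∷ 56 ∷ 62 ∷ 16 ∷ 54 ∷ 23 ∷ 14 ∷ 29 ∷ 27 ∷ 22 ∷ 49 ∷ 33 ∷ 26 ∷ 24 ∷ 47 ∷ 48 ∷ 13 ∷ 4 ∷ 37 ∷ 11 ∷ 30 ∷ 39 ∷ 32 ∷ 25 ∷ 38 ∷ 31 ∷ 0 ∷ [])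
  ∷ []
  ∷ []
  ∷ (9 ∷ 3 ∷ 31 ∷ 58 ∷ 10 ∷ 69 ∷ 74 ∷ 5 ∷ 61 ∷ 13 ∷ 0 ∷ 19 ∷ 27 ∷ 68 ∷ 4 ∷ 8 ∷ 55 ∷ 33 ∷ 64 ∷ 29 ∷ 45 ∷ 7 ∷ 42 ∷ 53 ∷ 46 ∷ 48 ∷ 26 ∷ 28 ∷ 40 ∷ 34 ∷ 15 ∷ 23 ∷ 17 ∷ 2 ∷ 49 ∷ 22 ∷ 43 ∷ 38 ∷ 39 ∷ 21 ∷ 18 ∷ 1 ∷ 36 ∷ [])
  ∷ (11 ∷ 24 ∷ 60 ∷ 18 ∷ 70 ∷ 66 ∷ 59 ∷ 6 ∷ 74 ∷ 47 ∷ 8 ∷ 65 ∷ 55 ∷ 2 ∷ 16 ∷ 5 ∷ 43 ∷ 14 ∷ 37 ∷ 7 ∷ 12 ∷ 21 ∷ 53 ∷ 56 ∷ 4 ∷ 52 ∷ 54 ∷ 0 ∷ 19 ∷ 9 ∷ 31 ∷ 39 ∷ 46 ∷ 36 ∷ 50 ∷ 25 ∷ 3 ∷ 48 ∷ 35 ∷ 10 ∷ 26 ∷ 42 ∷ 1 ∷ 38 ∷ [])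
  ∷ []
  ∷ []
  ∷ (12 ∷ 8 ∷ 70 ∷ 82 ∷ 79 ∷ 6 ∷ 75 ∷ 35 ∷ 55 ∷ 77 ∷ 29 ∷ 19 ∷ 76 ∷ 33 ∷ 4 ∷ 69 ∷ 53 ∷ 54 ∷ 10 ∷ 5 ∷ 0 ∷ 24 ∷ 56 ∷ 18 ∷ 2 ∷ 62 ∷ 31 ∷ 17 ∷ 37 ∷ 61 ∷ 36 ∷ 7 ∷ 23 ∷ 58 ∷ 15 ∷ 27 ∷ 34 ∷ 42 ∷ 38 ∷ 25 ∷ 21 ∷ 9 ∷ 16 ∷ 39 ∷ 45 ∷ 3 ∷ 1 ∷ [])
  ∷ (89 ∷ 5 ∷ 3 ∷ 24 ∷ 68 ∷ 72 ∷ 85 ∷ 81 ∷ 4 ∷ 67 ∷ 39 ∷ 75 ∷ 62 ∷ 13 ∷ 21 ∷ 15 ∷ 64 ∷ 52 ∷ 2 ∷ 66 ∷ 16 ∷ 40 ∷ 41 ∷ 6 ∷ 35 ∷ 0 ∷ 18 ∷ 30 ∷ 54 ∷ 12 ∷ 25 ∷ 9 ∷ 10 ∷ 48 ∷ 56 ∷ 33 ∷ 17 ∷ 19 ∷ 20 ∷ 45 ∷ 11 ∷ 34 ∷ 36 ∷ 49 ∷ 23 ∷ 26 ∷ 47 ∷ 1 ∷ [])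
  ∷ []
  ∷ []
  ∷ (22 ∷ 89 ∷ 80 ∷ 63 ∷ 3 ∷ 76 ∷ 15 ∷ 78 ∷ 88 ∷ 82 ∷ 18 ∷ 14 ∷ 86 ∷ 64 ∷ 75 ∷ 12 ∷ 40 ∷ 0 ∷ 51 ∷ 34 ∷ 16 ∷ 39 ∷ 13 ∷ 72 ∷ 10 ∷ 4 ∷ 57 ∷ 45 ∷ 60 ∷ 11 ∷ 41 ∷ 2 ∷ 47 ∷ 26 ∷ 17 ∷ 33 ∷ 6 ∷ 28 ∷ 25 ∷ 7 ∷ 52 ∷ 56 ∷ 5 ∷ 32 ∷ 20 ∷ 54 ∷ 21 ∷ 1 ∷ 46 ∷ 8 ∷ 43 ∷ [])
  ∷ (42 ∷ 6 ∷ 64 ∷ 65 ∷ 96 ∷ 14 ∷ 61 ∷ 3 ∷ 16 ∷ 88 ∷ 85 ∷ 82 ∷ 62 ∷ 78 ∷ 71 ∷ 20 ∷ 4 ∷ 35 ∷ 66 ∷ 17 ∷ 7 ∷ 2 ∷ 24 ∷ 8 ∷ 19 ∷ 1 ∷ 73 ∷ 43 ∷ 0 ∷ 5 ∷ 47 ∷ 34 ∷ 55 ∷ 46 ∷ 39 ∷ 63 ∷ 18 ∷ 13 ∷ 58 ∷ 51 ∷ 49 ∷ 40 ∷ 50 ∷ 15 ∷ 31 ∷ 10 ∷ 11 ∷ 41 ∷ 53 ∷ 23 ∷ 32 ∷ 27 ∷ [])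
  ∷ []
  ∷ []
  ∷ (84 ∷ 34 ∷ 94 ∷ 71 ∷ 9 ∷ 83 ∷ 95 ∷ 2 ∷ 65 ∷ 70 ∷ 39 ∷ 27 ∷ 77 ∷ 87 ∷ 8 ∷ 18 ∷ 38 ∷ 0 ∷ 80 ∷ 21 ∷ 66 ∷ 78 ∷ 4 ∷ 20 ∷ 17 ∷ 5 ∷ 25 ∷ 68 ∷ 69 ∷ 74 ∷ 1 ∷ 31 ∷ 13 ∷ 14 ∷ 72 ∷ 23 ∷ 12 ∷ 22 ∷ 6 ∷ 63 ∷ 54 ∷ 30 ∷ 48 ∷ 10 ∷ 36 ∷ 62 ∷ 41 ∷ 44 ∷ 57 ∷ 16 ∷ 7 ∷ 26 ∷ 52 ∷ 3 ∷ 29 ∷ [])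
  ∷ (22 ∷ 6 ∷ 89 ∷ 95 ∷ 4 ∷ 21 ∷ 41 ∷ 23 ∷ 60 ∷ 91 ∷ 15 ∷ 42 ∷ 96 ∷ 16 ∷ 69 ∷ 80 ∷ 45 ∷ 0 ∷ 84 ∷ 87 ∷ 68 ∷ 78 ∷ 33 ∷ 73 ∷ 11 ∷ 79 ∷ 8 ∷ 47 ∷ 75 ∷ 35 ∷ 50 ∷ 5 ∷ 54 ∷ 13 ∷ 7 ∷ 14 ∷ 2 ∷ 72 ∷ 52 ∷ 17 ∷ 61 ∷ 34 ∷ 39 ∷ 20 ∷ 25 ∷ 62 ∷ 26 ∷ 18 ∷ 44 ∷ 30 ∷ 12 ∷ 46 ∷ 53 ∷ 1 ∷ 3 ∷ 29 ∷ [])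
  ∷ []
  ∷ []
  ∷ (2 ∷ 16 ∷ 81 ∷ 92 ∷ 28 ∷ 88 ∷ 29 ∷ 91 ∷ 102 ∷ 13 ∷ 48 ∷ 50 ∷ 52 ∷ 3 ∷ 83 ∷ 30 ∷ 98 ∷ 86 ∷ 23 ∷ 82 ∷ 65 ∷ 17 ∷ 1 ∷ 21 ∷ 80 ∷ 11 ∷ 89 ∷ 10 ∷ 84 ∷ 76 ∷ 62 ∷ 8 ∷ 22 ∷ 36 ∷ 9 ∷ 32 ∷ 75 ∷ 70 ∷ 33 ∷ 67 ∷ 7 ∷ 31 ∷ 57 ∷ 6 ∷ 64 ∷ 14 ∷ 5 ∷ 44 ∷ 54 ∷ 26 ∷ 27 ∷ 15 ∷ 42 ∷ 35 ∷ 55 ∷ 58 ∷ 20 ∷ 0 ∷ 12 ∷ [])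
  ∷ (114 ∷ 108 ∷ 105 ∷ 102 ∷ 16 ∷ 82 ∷ 96 ∷ 19 ∷ 67 ∷ 46 ∷ 14 ∷ 10 ∷ 11 ∷ 85 ∷ 1 ∷ 98 ∷ 88 ∷ 94 ∷ 33 ∷ 74 ∷ 90 ∷ 4 ∷ 86 ∷ 58 ∷ 66 ∷ 51 ∷ 21 ∷ 40 ∷ 38 ∷ 24 ∷ 13 ∷ 9 ∷ 3 ∷ 29 ∷ 63 ∷ 47 ∷ 34 ∷ 80 ∷ 31 ∷ 35 ∷ 2 ∷ 32 ∷ 8 ∷ 5 ∷ 15 ∷ 54 ∷ 39 ∷ 7 ∷ 41 ∷ 30 ∷ 18 ∷ 65 ∷ 43 ∷ 48 ∷ 6 ∷ 36 ∷ 59 ∷ 20 ∷ 0 ∷ 12 ∷ [])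
  ∷ []
  ∷ []
  ∷ (15 ∷ 24 ∷ 99 ∷ 14 ∷ 1 ∷ 102 ∷ 10 ∷ 64 ∷ 105 ∷ 32 ∷ 101 ∷ 23 ∷ 94 ∷ 11 ∷ 4 ∷ 97 ∷ 92 ∷ 88 ∷ 78 ∷ 21 ∷ 96 ∷ 61 ∷ 46 ∷ 12 ∷ 95 ∷ 79 ∷ 48 ∷ 28 ∷ 81 ∷ 29 ∷ 9 ∷ 33 ∷ 16 ∷ 90 ∷ 39 ∷ 45 ∷ 53 ∷ 47 ∷ 49 ∷ 30 ∷ 2 ∷ 13 ∷ 25 ∷ 77 ∷ 34 ∷ 38 ∷ 72 ∷ 74 ∷ 8 ∷ 3 ∷ 67 ∷ 51 ∷ 5 ∷ 62 ∷ 31 ∷ 55 ∷ 35 ∷ 65 ∷ 40 ∷ 22 ∷ 6 ∷ 0 ∷ 52 ∷ [])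
  ∷ (111 ∷ 88 ∷ 106 ∷ 89 ∷ 1 ∷ 29 ∷ 93 ∷ 34 ∷ 30 ∷ 108 ∷ 11 ∷ 12 ∷ 6 ∷ 27 ∷ 87 ∷ 100 ∷ 26 ∷ 71 ∷ 17 ∷ 24 ∷ 102 ∷ 84 ∷ 72 ∷ 79 ∷ 83 ∷ 70 ∷ 41 ∷ 10 ∷ 5 ∷ 92 ∷ 14 ∷ 33 ∷ 13 ∷ 15 ∷ 78 ∷ 61 ∷ 48 ∷ 28 ∷ 22 ∷ 81 ∷ 38 ∷ 56 ∷ 82 ∷ 18 ∷ 8 ∷ 68 ∷ 73 ∷ 9 ∷ 2 ∷ 74 ∷ 3 ∷ 4 ∷ 31 ∷ 21 ∷ 49 ∷ 59 ∷ 19 ∷ 16 ∷ 60 ∷ 51 ∷ 65 ∷ 32 ∷ 0 ∷ 53 ∷ [])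
  ∷ []
  ∷ []
  ∷ (121 ∷ 22 ∷ 99 ∷ 14 ∷ 12 ∷ 125 ∷ 111 ∷ 2 ∷ 28 ∷ 102 ∷ 110 ∷ 8 ∷ 33 ∷ 5 ∷ 41 ∷ 51 ∷ 91 ∷ 87 ∷ 7 ∷ 96 ∷ 1 ∷ 37 ∷ 71 ∷ 80 ∷ 43 ∷ 58 ∷ 55 ∷ 30 ∷ 4 ∷ 9 ∷ 3 ∷ 53 ∷ 81 ∷ 93 ∷ 84 ∷ 15 ∷ 66 ∷ 75 ∷ 49 ∷ 90 ∷ 56 ∷ 24 ∷ 0 ∷ 79 ∷ 26 ∷ 31 ∷ 70 ∷ 39 ∷ 77 ∷ 13 ∷ 10 ∷ 73 ∷ 54 ∷ 6 ∷ 45 ∷ 50 ∷ 42 ∷ 74 ∷ 16 ∷ 36 ∷ 32 ∷ 29 ∷ 65 ∷ 17 ∷ 46 ∷ 63 ∷ 48 ∷ [])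
  ∷ (4 ∷ 92 ∷ 128 ∷ 30 ∷ 19 ∷ 108 ∷ 78 ∷ 2 ∷ 12 ∷ 27 ∷ 56 ∷ 114 ∷ 49 ∷ 88 ∷ 100 ∷ 37 ∷ 89 ∷ 106 ∷ 31 ∷ 109 ∷ 1 ∷ 9 ∷ 94 ∷ 15 ∷ 53 ∷ 97 ∷ 14 ∷ 18 ∷ 101 ∷ 52 ∷ 91 ∷ 87 ∷ 77 ∷ 58 ∷ 85 ∷ 34 ∷ 96 ∷ 20 ∷ 50 ∷ 0 ∷ 3 ∷ 76 ∷ 29 ∷ 21 ∷ 16 ∷ 10 ∷ 81 ∷ 61 ∷ 55 ∷ 75 ∷ 13 ∷ 7 ∷ 28 ∷ 67 ∷ 24 ∷ 17 ∷ 26 ∷ 5 ∷ 39 ∷ 43 ∷ 8 ∷ 72 ∷ 69 ∷ 33 ∷ 36 ∷ 46 ∷ 44 ∷ 48 ∷ [])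
  ∷ []
  ∷ []
  ∷ (112 ∷ 50 ∷ 123 ∷ 116 ∷ 40 ∷ 115 ∷ 7 ∷ 2 ∷ 94 ∷ 13 ∷ 129 ∷ 39 ∷ 88 ∷ 125 ∷ 103 ∷ 4 ∷ 93 ∷ 105 ∷ 9 ∷ 56 ∷ 43 ∷ 47 ∷ 109 ∷ 85 ∷ 108 ∷ 14 ∷ 17 ∷ 44 ∷ 107 ∷ 95 ∷ 37 ∷ 1 ∷ 55 ∷ 32 ∷ 6 ∷ 98 ∷ 26 ∷ 20 ∷ 38 ∷ 97 ∷ 18 ∷ 63 ∷ 86 ∷ 30 ∷ 3 ∷ 10 ∷ 48 ∷ 87 ∷ 68 ∷ 66 ∷ 80 ∷ 23 ∷ 8 ∷ 27 ∷ 36 ∷ 71 ∷ 0 ∷ 25 ∷ 31 ∷ 22 ∷ 51 ∷ 16 ∷ 35 ∷ 74 ∷ 54 ∷ 5 ∷ 33 ∷ 12 ∷ 61 ∷ 19 ∷ 28 ∷ [])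
  ∷ (10 ∷ 126 ∷ 98 ∷ 41 ∷ 29 ∷ 115 ∷ 72 ∷ 11 ∷ 113 ∷ 121 ∷ 25 ∷ 34 ∷ 127 ∷ 24 ∷ 58 ∷ 0 ∷ 116 ∷ 119 ∷ 110 ∷ 65 ∷ 14 ∷ 26 ∷ 27 ∷ 93 ∷ 33 ∷ 101 ∷ 62 ∷ 67 ∷ 109 ∷ 45 ∷ 103 ∷ 107 ∷ 108 ∷ 85 ∷ 56 ∷ 87 ∷ 32 ∷ 16 ∷ 66 ∷ 9 ∷ 2 ∷ 94 ∷ 8 ∷ 88 ∷ 22 ∷ 53 ∷ 21 ∷ 5 ∷ 75 ∷ 60 ∷ 84 ∷ 38 ∷ 63 ∷ 6 ∷ 1 ∷ 40 ∷ 73 ∷ 30 ∷ 19 ∷ 3 ∷ 81 ∷ 42 ∷ 18 ∷ 13 ∷ 48 ∷ 4 ∷ 15 ∷ 43 ∷ 7 ∷ 28 ∷ 23 ∷ 31 ∷ [])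
  ∷ []
  ∷ []
  ∷ (16 ∷ 137 ∷ 33 ∷ 127 ∷ 120 ∷ 7 ∷ 19 ∷ 136 ∷ 64 ∷ 9 ∷ 119 ∷ 110 ∷ 107 ∷ 34 ∷ 8 ∷ 99 ∷ 117 ∷ 17 ∷ 11 ∷ 112 ∷ 108 ∷ 111 ∷ 115 ∷ 41 ∷ 44 ∷ 114 ∷ 96 ∷ 22 ∷ 118 ∷ 53 ∷ 60 ∷ 5 ∷ 95 ∷ 26 ∷ 62 ∷ 39 ∷ 109 ∷ 48 ∷ 103 ∷ 63 ∷ 30 ∷ 40 ∷ 57 ∷ 55 ∷ 21 ∷ 43 ∷ 10 ∷ 45 ∷ 0 ∷ 42 ∷ 54 ∷ 6 ∷ 71 ∷ 23 ∷ 46 ∷ 89 ∷ 28 ∷ 29 ∷ 82 ∷ 52 ∷ 35 ∷ 75 ∷ 1 ∷ 4 ∷ 25 ∷ 12 ∷ 13 ∷ 80 ∷ 15 ∷ 2 ∷ 56 ∷ 32 ∷ 3 ∷ 47 ∷ 68 ∷ [])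
  ∷ (132 ∷ 138 ∷ 121 ∷ 10 ∷ 140 ∷ 25 ∷ 46 ∷ 97 ∷ 4 ∷ 115 ∷ 98 ∷ 17 ∷ 116 ∷ 124 ∷ 113 ∷ 6 ∷ 118 ∷ 22 ∷ 81 ∷ 99 ∷ 83 ∷ 35 ∷ 111 ∷ 75 ∷ 12 ∷ 62 ∷ 79 ∷ 2 ∷ 112 ∷ 20 ∷ 7 ∷ 19 ∷ 11 ∷ 73 ∷ 13 ∷ 26 ∷ 42 ∷ 104 ∷ 37 ∷ 9 ∷ 28 ∷ 48 ∷ 24 ∷ 102 ∷ 18 ∷ 0 ∷ 5 ∷ 36 ∷ 59 ∷ 43 ∷ 8 ∷ 40 ∷ 34 ∷ 67 ∷ 71 ∷ 33 ∷ 92 ∷ 86 ∷ 57 ∷ 87 ∷ 61 ∷ 56 ∷ 69 ∷ 66 ∷ 78 ∷ 29 ∷ 16 ∷ 82 ∷ 44 ∷ 3 ∷ 65 ∷ 55 ∷ 21 ∷ 1 ∷ 27 ∷ 72 ∷ [])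
  ∷ []
  ∷ []
  ∷ (11 ∷ 139 ∷ 26 ∷ 130 ∷ 137 ∷ 9 ∷ 113 ∷ 1 ∷ 98 ∷ 35 ∷ 24 ∷ 15 ∷ 33 ∷ 92 ∷ 85 ∷ 132 ∷ 86 ∷ 54 ∷ 131 ∷ 63 ∷ 19 ∷ 105 ∷ 94 ∷ 20 ∷ 124 ∷ 117 ∷ 95 ∷ 119 ∷ 7 ∷ 125 ∷ 0 ∷ 17 ∷ 76 ∷ 52 ∷ 80 ∷ 115 ∷ 96 ∷ 25 ∷ 2 ∷ 58 ∷ 29 ∷ 12 ∷ 23 ∷ 34 ∷ 66 ∷ 6 ∷ 109 ∷ 39 ∷ 18 ∷ 89 ∷ 48 ∷ 4 ∷ 8 ∷ 83 ∷ 5 ∷ 40 ∷ 56 ∷ 43 ∷ 22 ∷ 65 ∷ 93 ∷ 90 ∷ 14 ∷ 38 ∷ 70 ∷ 74 ∷ 77 ∷ 60 ∷ 21 ∷ 49 ∷ 3 ∷ 81 ∷ 59 ∷ 72 ∷ 51 ∷ 69 ∷ 44 ∷ 27 ∷ 31 ∷ [])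
  ∷ (48 ∷ 130 ∷ 58 ∷ 131 ∷ 24 ∷ 9 ∷ 90 ∷ 1 ∷ 135 ∷ 60 ∷ 6 ∷ 103 ∷ 140 ∷ 143 ∷ 76 ∷ 109 ∷ 137 ∷ 23 ∷ 129 ∷ 102 ∷ 124 ∷ 127 ∷ 115 ∷ 41 ∷ 35 ∷ 17 ∷ 21 ∷ 67 ∷ 122 ∷ 7 ∷ 0 ∷ 101 ∷ 3 ∷ 43 ∷ 121 ∷ 111 ∷ 56 ∷ 86 ∷ 11 ∷ 5 ∷ 26 ∷ 34 ∷ 75 ∷ 114 ∷ 64 ∷ 22 ∷ 65 ∷ 36 ∷ 20 ∷ 105 ∷ 89 ∷ 4 ∷ 97 ∷ 63 ∷ 25 ∷ 47 ∷ 15 ∷ 29 ∷ 39 ∷ 83 ∷ 80 ∷ 45 ∷ 53 ∷ 28 ∷ 40 ∷ 33 ∷ 52 ∷ 84 ∷ 12 ∷ 8 ∷ 2 ∷ 55 ∷ 13 ∷ 72 ∷ 19 ∷ 14 ∷ 54 ∷ 59 ∷ 27 ∷ 31 ∷ [])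
  ∷ []
  ∷ []
  ∷ (139 ∷ 18 ∷ 7 ∷ 52 ∷ 24 ∷ 9 ∷ 15 ∷ 70 ∷ 38 ∷ 64 ∷ 132 ∷ 134 ∷ 47 ∷ 4 ∷ 55 ∷ 148 ∷ 133 ∷ 31 ∷ 109 ∷ 125 ∷ 118 ∷ 137 ∷ 99 ∷ 138 ∷ 28 ∷ 93 ∷ 100 ∷ 3 ∷ 33 ∷ 42 ∷ 85 ∷ 112 ∷ 10 ∷ 27 ∷ 122 ∷ 119 ∷ 83 ∷ 1 ∷ 90 ∷ 2 ∷ 107 ∷ 13 ∷ 25 ∷ 60 ∷ 116 ∷ 41 ∷ 53 ∷ 104 ∷ 86 ∷ 84 ∷ 103 ∷ 6 ∷ 22 ∷ 72 ∷ 39 ∷ 45 ∷ 106 ∷ 65 ∷ 51 ∷ 37 ∷ 12 ∷ 94 ∷ 97 ∷ 78 ∷ 0 ∷ 29 ∷ 58 ∷ 46 ∷ 17 ∷ 20 ∷ 82 ∷ 35 ∷ 68 ∷ 77 ∷ 5 ∷ 36 ∷ 14 ∷ 80 ∷ 34 ∷ 8 ∷ 49 ∷ 67 ∷ 26 ∷ [])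
  ∷ (138 ∷ 2 ∷ 12 ∷ 149 ∷ 116 ∷ 47 ∷ 65 ∷ 10 ∷ 26 ∷ 139 ∷ 15 ∷ 45 ∷ 94 ∷ 6 ∷ 147 ∷ 67 ∷ 95 ∷ 9 ∷ 46 ∷ 43 ∷ 0 ∷ 14 ∷ 135 ∷ 119 ∷ 129 ∷ 25 ∷ 7 ∷ 57 ∷ 136 ∷ 1 ∷ 109 ∷ 118 ∷ 4 ∷ 125 ∷ 92 ∷ 60 ∷ 11 ∷ 24 ∷ 50 ∷ 40 ∷ 75 ∷ 121 ∷ 87 ∷ 55 ∷ 13 ∷ 85 ∷ 29 ∷ 103 ∷ 80 ∷ 91 ∷ 62 ∷ 93 ∷ 69 ∷ 34 ∷ 111 ∷ 88 ∷ 18 ∷ 102 ∷ 98 ∷ 17 ∷ 53 ∷ 70 ∷ 101 ∷ 42 ∷ 96 ∷ 39 ∷ 3 ∷ 74 ∷ 83 ∷ 8 ∷ 48 ∷ 51 ∷ 30 ∷ 82 ∷ 61 ∷ 33 ∷ 56 ∷ 20 ∷ 68 ∷ 31 ∷ 23 ∷ 44 ∷ 72 ∷ 41 ∷ [])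
  ∷ []

-- Row n lists, for each position j < 2n, the slot of that pairing occupying j.
occupantTable : List (List ℕ)
occupantTable =
  []
  ∷ []
  ∷ []
  ∷ (2 ∷ 0 ∷ 1 ∷ 3 ∷ 5 ∷ 4 ∷ [])
  ∷ (3 ∷ 0 ∷ 2 ∷ 4 ∷ 1 ∷ 7 ∷ 6 ∷ 5 ∷ [])
  ∷ []
  ∷ []
  ∷ (5 ∷ 0 ∷ 4 ∷ 7 ∷ 6 ∷ 2 ∷ 3 ∷ 12 ∷ 11 ∷ 9 ∷ 1 ∷ 10 ∷ 13 ∷ 8 ∷ [])
  ∷ (0 ∷ 5 ∷ 8 ∷ 4 ∷ 7 ∷ 3 ∷ 6 ∷ 2 ∷ 13 ∷ 12 ∷ 11 ∷ 10 ∷ 1 ∷ 15 ∷ 14 ∷ 9 ∷ [])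
  ∷ []
  ∷ []
  ∷ (2 ∷ 7 ∷ 1 ∷ 4 ∷ 13 ∷ 12 ∷ 9 ∷ 10 ∷ 8 ∷ 15 ∷ 18 ∷ 3 ∷ 6 ∷ 0 ∷ 5 ∷ 11 ∷ 14 ∷ 20 ∷ 19 ∷ 21 ∷ 17 ∷ 16 ∷ [])
  ∷ (4 ∷ 1 ∷ 8 ∷ 5 ∷ 13 ∷ 10 ∷ 16 ∷ 9 ∷ 11 ∷ 0 ∷ 17 ∷ 12 ∷ 20 ∷ 7 ∷ 3 ∷ 6 ∷ 2 ∷ 22 ∷ 21 ∷ 15 ∷ 14 ∷ 23 ∷ 19 ∷ 18 ∷ [])
  ∷ []
  ∷ []
  ∷ (12 ∷ 14 ∷ 3 ∷ 11 ∷ 6 ∷ 2 ∷ 5 ∷ 18 ∷ 10 ∷ 17 ∷ 9 ∷ 13 ∷ 21 ∷ 20 ∷ 27 ∷ 7 ∷ 26 ∷ 29 ∷ 8 ∷ 1 ∷ 25 ∷ 24 ∷ 16 ∷ 4 ∷ 22 ∷ 0 ∷ 28 ∷ 15 ∷ 23 ∷ 19 ∷ [])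
  ∷ (7 ∷ 15 ∷ 13 ∷ 2 ∷ 8 ∷ 14 ∷ 4 ∷ 18 ∷ 9 ∷ 23 ∷ 12 ∷ 3 ∷ 20 ∷ 10 ∷ 24 ∷ 11 ∷ 19 ∷ 29 ∷ 31 ∷ 25 ∷ 5 ∷ 30 ∷ 6 ∷ 1 ∷ 28 ∷ 26 ∷ 17 ∷ 21 ∷ 27 ∷ 0 ∷ 22 ∷ 16 ∷ [])
  ∷ []
  ∷ []
  ∷ (17 ∷ 5 ∷ 8 ∷ 1 ∷ 16 ∷ 14 ∷ 20 ∷ 6 ∷ 24 ∷ 2 ∷ 4 ∷ 18 ∷ 27 ∷ 21 ∷ 13 ∷ 25 ∷ 23 ∷ 11 ∷ 15 ∷ 36 ∷ 12 ∷ 33 ∷ 35 ∷ 7 ∷ 10 ∷ 0 ∷ 9 ∷ 19 ∷ 3 ∷ 32 ∷ 30 ∷ 37 ∷ 26 ∷ 22 ∷ 31 ∷ 34 ∷ 29 ∷ 28 ∷ [])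
  ∷ (18 ∷ 8 ∷ 1 ∷ 13 ∷ 17 ∷ 21 ∷ 6 ∷ 4 ∷ 2 ∷ 19 ∷ 9 ∷ 28 ∷ 22 ∷ 24 ∷ 26 ∷ 12 ∷ 14 ∷ 15 ∷ 33 ∷ 16 ∷ 38 ∷ 29 ∷ 7 ∷ 37 ∷ 10 ∷ 0 ∷ 11 ∷ 20 ∷ 5 ∷ 32 ∷ 39 ∷ 27 ∷ 34 ∷ 3 ∷ 35 ∷ 25 ∷ 30 ∷ 36 ∷ 23 ∷ 31 ∷ [])
  ∷ []
  ∷ []
  ∷ (2 ∷ 21 ∷ 10 ∷ 18 ∷ 25 ∷ 1 ∷ 8 ∷ 3 ∷ 24 ∷ 14 ∷ 22 ∷ 20 ∷ 26 ∷ 4 ∷ 33 ∷ 15 ∷ 31 ∷ 11 ∷ 16 ∷ 27 ∷ 17 ∷ 5 ∷ 19 ∷ 41 ∷ 44 ∷ 37 ∷ 13 ∷ 9 ∷ 28 ∷ 6 ∷ 34 ∷ 12 ∷ 38 ∷ 43 ∷ 45 ∷ 7 ∷ 39 ∷ 29 ∷ 32 ∷ 40 ∷ 0 ∷ 36 ∷ 23 ∷ 42 ∷ 30 ∷ 35 ∷ [])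
  ∷ (6 ∷ 22 ∷ 0 ∷ 13 ∷ 24 ∷ 14 ∷ 5 ∷ 7 ∷ 30 ∷ 21 ∷ 10 ∷ 18 ∷ 16 ∷ 29 ∷ 11 ∷ 20 ∷ 31 ∷ 9 ∷ 37 ∷ 15 ∷ 23 ∷ 38 ∷ 34 ∷ 17 ∷ 12 ∷ 46 ∷ 19 ∷ 35 ∷ 33 ∷ 3 ∷ 40 ∷ 42 ∷ 45 ∷ 8 ∷ 27 ∷ 2 ∷ 39 ∷ 44 ∷ 36 ∷ 26 ∷ 4 ∷ 1 ∷ 41 ∷ 32 ∷ 25 ∷ 47 ∷ 28 ∷ 43 ∷ [])
  ∷ []
  ∷ []
  ∷ (18 ∷ 1 ∷ 15 ∷ 12 ∷ 28 ∷ 20 ∷ 8 ∷ 23 ∷ 11 ∷ 13 ∷ 3 ∷ 21 ∷ 25 ∷ 7 ∷ 26 ∷ 30 ∷ 35 ∷ 39 ∷ 5 ∷ 42 ∷ 45 ∷ 38 ∷ 34 ∷ 24 ∷ 40 ∷ 32 ∷ 10 ∷ 47 ∷ 22 ∷ 14 ∷ 19 ∷ 17 ∷ 50 ∷ 6 ∷ 48 ∷ 16 ∷ 9 ∷ 4 ∷ 37 ∷ 52 ∷ 2 ∷ 33 ∷ 53 ∷ 31 ∷ 29 ∷ 41 ∷ 0 ∷ 36 ∷ 27 ∷ 51 ∷ 44 ∷ 46 ∷ 49 ∷ 43 ∷ [])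
  ∷ (0 ∷ 14 ∷ 28 ∷ 27 ∷ 20 ∷ 17 ∷ 26 ∷ 21 ∷ 8 ∷ 10 ∷ 11 ∷ 2 ∷ 24 ∷ 18 ∷ 19 ∷ 30 ∷ 13 ∷ 42 ∷ 36 ∷ 16 ∷ 22 ∷ 38 ∷ 3 ∷ 39 ∷ 45 ∷ 23 ∷ 48 ∷ 31 ∷ 25 ∷ 15 ∷ 49 ∷ 41 ∷ 55 ∷ 46 ∷ 54 ∷ 47 ∷ 4 ∷ 44 ∷ 52 ∷ 12 ∷ 9 ∷ 6 ∷ 32 ∷ 7 ∷ 50 ∷ 1 ∷ 43 ∷ 5 ∷ 29 ∷ 34 ∷ 51 ∷ 37 ∷ 35 ∷ 40 ∷ 33 ∷ 53 ∷ [])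
  ∷ []
  ∷ []
  ∷ (28 ∷ 18 ∷ 3 ∷ 30 ∷ 23 ∷ 6 ∷ 14 ∷ 34 ∷ 5 ∷ 0 ∷ 7 ∷ 31 ∷ 24 ∷ 37 ∷ 29 ∷ 36 ∷ 9 ∷ 13 ∷ 22 ∷ 38 ∷ 19 ∷ 49 ∷ 45 ∷ 27 ∷ 8 ∷ 12 ∷ 25 ∷ 40 ∷ 21 ∷ 54 ∷ 59 ∷ 26 ∷ 44 ∷ 20 ∷ 39 ∷ 61 ∷ 10 ∷ 17 ∷ 55 ∷ 43 ∷ 15 ∷ 50 ∷ 53 ∷ 16 ∷ 4 ∷ 60 ∷ 1 ∷ 11 ∷ 41 ∷ 32 ∷ 35 ∷ 52 ∷ 58 ∷ 56 ∷ 2 ∷ 51 ∷ 48 ∷ 46 ∷ 33 ∷ 57 ∷ 42 ∷ 47 ∷ [])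
  ∷ (23 ∷ 14 ∷ 9 ∷ 31 ∷ 12 ∷ 22 ∷ 4 ∷ 19 ∷ 5 ∷ 26 ∷ 27 ∷ 29 ∷ 36 ∷ 41 ∷ 30 ∷ 37 ∷ 13 ∷ 46 ∷ 44 ∷ 24 ∷ 16 ∷ 28 ∷ 20 ∷ 2 ∷ 0 ∷ 55 ∷ 32 ∷ 34 ∷ 51 ∷ 54 ∷ 18 ∷ 45 ∷ 21 ∷ 17 ∷ 25 ∷ 11 ∷ 63 ∷ 58 ∷ 48 ∷ 59 ∷ 7 ∷ 10 ∷ 61 ∷ 15 ∷ 52 ∷ 56 ∷ 62 ∷ 8 ∷ 43 ∷ 39 ∷ 50 ∷ 60 ∷ 49 ∷ 42 ∷ 6 ∷ 53 ∷ 1 ∷ 40 ∷ 3 ∷ 33 ∷ 47 ∷ 57 ∷ 38 ∷ 35 ∷ [])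
  ∷ []
  ∷ []
  ∷ (9 ∷ 22 ∷ 29 ∷ 23 ∷ 18 ∷ 15 ∷ 31 ∷ 34 ∷ 17 ∷ 30 ∷ 32 ∷ 44 ∷ 1 ∷ 8 ∷ 20 ∷ 36 ∷ 24 ∷ 28 ∷ 11 ∷ 13 ∷ 16 ∷ 27 ∷ 50 ∷ 43 ∷ 53 ∷ 57 ∷ 12 ∷ 52 ∷ 58 ∷ 21 ∷ 25 ∷ 46 ∷ 33 ∷ 64 ∷ 48 ∷ 14 ∷ 55 ∷ 26 ∷ 51 ∷ 66 ∷ 47 ∷ 65 ∷ 59 ∷ 69 ∷ 67 ∷ 19 ∷ 6 ∷ 63 ∷ 3 ∷ 10 ∷ 62 ∷ 49 ∷ 56 ∷ 38 ∷ 41 ∷ 5 ∷ 0 ∷ 60 ∷ 35 ∷ 7 ∷ 2 ∷ 45 ∷ 40 ∷ 4 ∷ 37 ∷ 61 ∷ 54 ∷ 68 ∷ 42 ∷ 39 ∷ [])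
  ∷ (9 ∷ 24 ∷ 33 ∷ 10 ∷ 18 ∷ 2 ∷ 4 ∷ 35 ∷ 15 ∷ 38 ∷ 17 ∷ 45 ∷ 40 ∷ 26 ∷ 32 ∷ 46 ∷ 29 ∷ 19 ∷ 12 ∷ 5 ∷ 34 ∷ 13 ∷ 31 ∷ 28 ∷ 54 ∷ 51 ∷ 41 ∷ 60 ∷ 16 ∷ 53 ∷ 7 ∷ 21 ∷ 48 ∷ 23 ∷ 30 ∷ 25 ∷ 49 ∷ 69 ∷ 55 ∷ 43 ∷ 22 ∷ 62 ∷ 27 ∷ 20 ∷ 71 ∷ 14 ∷ 52 ∷ 65 ∷ 68 ∷ 1 ∷ 8 ∷ 6 ∷ 37 ∷ 64 ∷ 57 ∷ 67 ∷ 70 ∷ 11 ∷ 59 ∷ 42 ∷ 44 ∷ 50 ∷ 61 ∷ 3 ∷ 58 ∷ 56 ∷ 66 ∷ 0 ∷ 39 ∷ 36 ∷ 47 ∷ 63 ∷ [])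
  ∷ []
  ∷ []
  ∷ (38 ∷ 15 ∷ 5 ∷ 24 ∷ 29 ∷ 35 ∷ 31 ∷ 22 ∷ 6 ∷ 44 ∷ 10 ∷ 12 ∷ 13 ∷ 4 ∷ 16 ∷ 33 ∷ 45 ∷ 27 ∷ 54 ∷ 43 ∷ 34 ∷ 0 ∷ 49 ∷ 39 ∷ 8 ∷ 51 ∷ 36 ∷ 52 ∷ 23 ∷ 63 ∷ 30 ∷ 61 ∷ 55 ∷ 37 ∷ 47 ∷ 68 ∷ 32 ∷ 20 ∷ 21 ∷ 70 ∷ 77 ∷ 25 ∷ 74 ∷ 3 ∷ 28 ∷ 18 ∷ 66 ∷ 2 ∷ 42 ∷ 26 ∷ 72 ∷ 41 ∷ 9 ∷ 62 ∷ 19 ∷ 14 ∷ 73 ∷ 17 ∷ 7 ∷ 59 ∷ 11 ∷ 60 ∷ 69 ∷ 48 ∷ 75 ∷ 57 ∷ 1 ∷ 46 ∷ 64 ∷ 40 ∷ 71 ∷ 53 ∷ 76 ∷ 50 ∷ 67 ∷ 58 ∷ 56 ∷ 65 ∷ [])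
  ∷ (39 ∷ 9 ∷ 1 ∷ 3 ∷ 30 ∷ 41 ∷ 10 ∷ 11 ∷ 43 ∷ 8 ∷ 5 ∷ 32 ∷ 49 ∷ 29 ∷ 19 ∷ 4 ∷ 16 ∷ 45 ∷ 50 ∷ 48 ∷ 51 ∷ 44 ∷ 22 ∷ 18 ∷ 26 ∷ 36 ∷ 25 ∷ 21 ∷ 12 ∷ 20 ∷ 33 ∷ 38 ∷ 35 ∷ 24 ∷ 56 ∷ 59 ∷ 70 ∷ 31 ∷ 37 ∷ 34 ∷ 13 ∷ 79 ∷ 52 ∷ 58 ∷ 69 ∷ 72 ∷ 62 ∷ 27 ∷ 28 ∷ 23 ∷ 61 ∷ 60 ∷ 66 ∷ 65 ∷ 17 ∷ 53 ∷ 14 ∷ 2 ∷ 7 ∷ 64 ∷ 6 ∷ 42 ∷ 15 ∷ 76 ∷ 0 ∷ 73 ∷ 40 ∷ 47 ∷ 46 ∷ 75 ∷ 71 ∷ 78 ∷ 54 ∷ 57 ∷ 63 ∷ 74 ∷ 67 ∷ 77 ∷ 68 ∷ 55 ∷ [])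
  ∷ []
  ∷ []
  ∷ (10 ∷ 41 ∷ 33 ∷ 1 ∷ 14 ∷ 7 ∷ 44 ∷ 21 ∷ 15 ∷ 0 ∷ 4 ∷ 43 ∷ 53 ∷ 9 ∷ 50 ∷ 30 ∷ 47 ∷ 32 ∷ 40 ∷ 11 ∷ 57 ∷ 39 ∷ 35 ∷ 31 ∷ 52 ∷ 58 ∷ 26 ∷ 12 ∷ 27 ∷ 19 ∷ 64 ∷ 2 ∷ 54 ∷ 17 ∷ 29 ∷ 45 ∷ 42 ∷ 76 ∷ 37 ∷ 38 ∷ 28 ∷ 55 ∷ 22 ∷ 36 ∷ 84 ∷ 20 ∷ 24 ∷ 73 ∷ 25 ∷ 34 ∷ 62 ∷ 75 ∷ 60 ∷ 23 ∷ 69 ∷ 16 ∷ 74 ∷ 70 ∷ 3 ∷ 78 ∷ 83 ∷ 8 ∷ 82 ∷ 46 ∷ 18 ∷ 72 ∷ 65 ∷ 63 ∷ 13 ∷ 5 ∷ 71 ∷ 51 ∷ 67 ∷ 59 ∷ 6 ∷ 68 ∷ 48 ∷ 80 ∷ 66 ∷ 81 ∷ 85 ∷ 79 ∷ 49 ∷ 56 ∷ 61 ∷ 77 ∷ [])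
  ∷ (27 ∷ 42 ∷ 13 ∷ 36 ∷ 24 ∷ 15 ∷ 7 ∷ 19 ∷ 10 ∷ 29 ∷ 39 ∷ 0 ∷ 20 ∷ 44 ∷ 17 ∷ 51 ∷ 14 ∷ 57 ∷ 3 ∷ 28 ∷ 54 ∷ 21 ∷ 59 ∷ 47 ∷ 1 ∷ 35 ∷ 40 ∷ 45 ∷ 63 ∷ 71 ∷ 68 ∷ 30 ∷ 58 ∷ 61 ∷ 64 ∷ 38 ∷ 33 ∷ 18 ∷ 43 ∷ 31 ∷ 73 ∷ 80 ∷ 41 ∷ 16 ∷ 65 ∷ 86 ∷ 32 ∷ 9 ∷ 37 ∷ 72 ∷ 34 ∷ 83 ∷ 25 ∷ 22 ∷ 26 ∷ 12 ∷ 23 ∷ 62 ∷ 53 ∷ 6 ∷ 2 ∷ 60 ∷ 79 ∷ 74 ∷ 46 ∷ 11 ∷ 5 ∷ 50 ∷ 84 ∷ 56 ∷ 4 ∷ 77 ∷ 75 ∷ 49 ∷ 8 ∷ 82 ∷ 48 ∷ 66 ∷ 55 ∷ 69 ∷ 76 ∷ 67 ∷ 70 ∷ 87 ∷ 52 ∷ 85 ∷ 78 ∷ 81 ∷ [])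
  ∷ []
  ∷ []
  ∷ (20 ∷ 46 ∷ 24 ∷ 45 ∷ 14 ∷ 19 ∷ 5 ∷ 31 ∷ 1 ∷ 41 ∷ 18 ∷ 48 ∷ 0 ∷ 52 ∷ 47 ∷ 34 ∷ 42 ∷ 27 ∷ 23 ∷ 11 ∷ 61 ∷ 40 ∷ 67 ∷ 32 ∷ 21 ∷ 39 ∷ 66 ∷ 35 ∷ 71 ∷ 10 ∷ 65 ∷ 26 ∷ 58 ∷ 13 ∷ 36 ∷ 7 ∷ 30 ∷ 28 ∷ 38 ∷ 43 ∷ 78 ∷ 57 ∷ 37 ∷ 70 ∷ 54 ∷ 44 ∷ 74 ∷ 68 ∷ 60 ∷ 93 ∷ 92 ∷ 81 ∷ 88 ∷ 16 ∷ 17 ∷ 8 ∷ 22 ∷ 79 ∷ 33 ∷ 73 ∷ 89 ∷ 29 ∷ 25 ∷ 87 ∷ 82 ∷ 55 ∷ 86 ∷ 75 ∷ 77 ∷ 15 ∷ 2 ∷ 63 ∷ 83 ∷ 64 ∷ 49 ∷ 6 ∷ 12 ∷ 9 ∷ 85 ∷ 4 ∷ 69 ∷ 84 ∷ 3 ∷ 53 ∷ 90 ∷ 51 ∷ 62 ∷ 50 ∷ 56 ∷ 72 ∷ 59 ∷ 91 ∷ 76 ∷ 80 ∷ [])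
  ∷ (25 ∷ 47 ∷ 18 ∷ 2 ∷ 8 ∷ 1 ∷ 23 ∷ 50 ∷ 49 ∷ 31 ∷ 32 ∷ 40 ∷ 29 ∷ 13 ∷ 56 ∷ 15 ∷ 20 ∷ 36 ∷ 26 ∷ 37 ∷ 38 ∷ 14 ∷ 66 ∷ 44 ∷ 3 ∷ 30 ∷ 45 ∷ 73 ∷ 61 ∷ 51 ∷ 27 ∷ 71 ∷ 63 ∷ 35 ∷ 41 ∷ 24 ∷ 42 ∷ 62 ∷ 68 ∷ 10 ∷ 21 ∷ 22 ∷ 79 ∷ 77 ∷ 80 ∷ 39 ∷ 74 ∷ 46 ∷ 33 ∷ 43 ∷ 95 ∷ 58 ∷ 17 ∷ 88 ∷ 28 ∷ 84 ∷ 34 ∷ 78 ∷ 85 ∷ 75 ∷ 86 ∷ 72 ∷ 12 ∷ 69 ∷ 16 ∷ 70 ∷ 19 ∷ 9 ∷ 4 ∷ 92 ∷ 83 ∷ 65 ∷ 5 ∷ 93 ∷ 52 ∷ 11 ∷ 60 ∷ 89 ∷ 57 ∷ 53 ∷ 90 ∷ 7 ∷ 64 ∷ 81 ∷ 76 ∷ 6 ∷ 87 ∷ 67 ∷ 59 ∷ 0 ∷ 55 ∷ 48 ∷ 82 ∷ 54 ∷ 91 ∷ 94 ∷ [])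
  ∷ []
  ∷ []
  ∷ (17 ∷ 47 ∷ 31 ∷ 4 ∷ 25 ∷ 42 ∷ 36 ∷ 39 ∷ 49 ∷ 55 ∷ 24 ∷ 29 ∷ 15 ∷ 22 ∷ 11 ∷ 6 ∷ 20 ∷ 34 ∷ 10 ∷ 68 ∷ 44 ∷ 46 ∷ 0 ∷ 57 ∷ 51 ∷ 38 ∷ 33 ∷ 62 ∷ 37 ∷ 66 ∷ 61 ∷ 76 ∷ 43 ∷ 35 ∷ 19 ∷ 82 ∷ 75 ∷ 73 ∷ 71 ∷ 21 ∷ 16 ∷ 30 ∷ 80 ∷ 50 ∷ 87 ∷ 27 ∷ 48 ∷ 32 ∷ 90 ∷ 93 ∷ 98 ∷ 18 ∷ 40 ∷ 85 ∷ 45 ∷ 70 ∷ 41 ∷ 26 ∷ 67 ∷ 100 ∷ 28 ∷ 84 ∷ 72 ∷ 3 ∷ 13 ∷ 89 ∷ 95 ∷ 88 ∷ 54 ∷ 97 ∷ 86 ∷ 69 ∷ 23 ∷ 81 ∷ 78 ∷ 14 ∷ 5 ∷ 94 ∷ 7 ∷ 64 ∷ 2 ∷ 83 ∷ 9 ∷ 56 ∷ 53 ∷ 77 ∷ 12 ∷ 58 ∷ 8 ∷ 1 ∷ 79 ∷ 65 ∷ 52 ∷ 60 ∷ 91 ∷ 101 ∷ 99 ∷ 74 ∷ 59 ∷ 92 ∷ 63 ∷ 96 ∷ [])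
  ∷ (28 ∷ 25 ∷ 21 ∷ 7 ∷ 16 ∷ 29 ∷ 1 ∷ 20 ∷ 23 ∷ 53 ∷ 45 ∷ 46 ∷ 59 ∷ 37 ∷ 5 ∷ 43 ∷ 8 ∷ 19 ∷ 36 ∷ 24 ∷ 15 ∷ 57 ∷ 68 ∷ 49 ∷ 22 ∷ 73 ∷ 60 ∷ 51 ∷ 77 ∷ 72 ∷ 80 ∷ 44 ∷ 50 ∷ 75 ∷ 31 ∷ 17 ∷ 81 ∷ 67 ∷ 71 ∷ 34 ∷ 41 ∷ 47 ∷ 0 ∷ 27 ∷ 52 ∷ 76 ∷ 33 ∷ 30 ∷ 74 ∷ 40 ∷ 42 ∷ 39 ∷ 89 ∷ 48 ∷ 69 ∷ 32 ∷ 88 ∷ 97 ∷ 38 ∷ 98 ∷ 95 ∷ 6 ∷ 12 ∷ 35 ∷ 2 ∷ 3 ∷ 18 ∷ 83 ∷ 54 ∷ 58 ∷ 55 ∷ 14 ∷ 79 ∷ 26 ∷ 101 ∷ 86 ∷ 64 ∷ 96 ∷ 13 ∷ 82 ∷ 103 ∷ 85 ∷ 11 ∷ 93 ∷ 102 ∷ 10 ∷ 70 ∷ 66 ∷ 9 ∷ 84 ∷ 99 ∷ 92 ∷ 91 ∷ 65 ∷ 94 ∷ 63 ∷ 4 ∷ 62 ∷ 90 ∷ 61 ∷ 87 ∷ 78 ∷ 56 ∷ 100 ∷ [])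
  ∷ []
  ∷ []
  ∷ (17 ∷ 30 ∷ 7 ∷ 53 ∷ 22 ∷ 25 ∷ 38 ∷ 50 ∷ 14 ∷ 4 ∷ 43 ∷ 62 ∷ 36 ∷ 32 ∷ 33 ∷ 59 ∷ 49 ∷ 24 ∷ 15 ∷ 72 ∷ 23 ∷ 19 ∷ 37 ∷ 35 ∷ 69 ∷ 26 ∷ 51 ∷ 11 ∷ 77 ∷ 54 ∷ 41 ∷ 31 ∷ 80 ∷ 85 ∷ 1 ∷ 70 ∷ 44 ∷ 56 ∷ 16 ∷ 10 ∷ 66 ∷ 46 ∷ 74 ∷ 79 ∷ 47 ∷ 78 ∷ 93 ∷ 87 ∷ 42 ∷ 88 ∷ 91 ∷ 65 ∷ 52 ∷ 81 ∷ 40 ∷ 98 ∷ 71 ∷ 48 ∷ 108 ∷ 105 ∷ 90 ∷ 92 ∷ 45 ∷ 39 ∷ 86 ∷ 8 ∷ 20 ∷ 104 ∷ 27 ∷ 28 ∷ 9 ∷ 3 ∷ 34 ∷ 96 ∷ 29 ∷ 63 ∷ 58 ∷ 12 ∷ 21 ∷ 106 ∷ 18 ∷ 64 ∷ 99 ∷ 5 ∷ 0 ∷ 109 ∷ 55 ∷ 13 ∷ 75 ∷ 101 ∷ 60 ∷ 67 ∷ 97 ∷ 102 ∷ 2 ∷ 6 ∷ 95 ∷ 82 ∷ 57 ∷ 83 ∷ 73 ∷ 76 ∷ 68 ∷ 61 ∷ 94 ∷ 84 ∷ 107 ∷ 103 ∷ 89 ∷ 100 ∷ [])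
  ∷ (17 ∷ 53 ∷ 36 ∷ 54 ∷ 4 ∷ 31 ∷ 1 ∷ 34 ∷ 26 ∷ 57 ∷ 60 ∷ 24 ∷ 50 ∷ 33 ∷ 35 ∷ 10 ∷ 13 ∷ 39 ∷ 47 ∷ 73 ∷ 43 ∷ 5 ∷ 0 ∷ 7 ∷ 56 ∷ 44 ∷ 46 ∷ 66 ∷ 61 ∷ 55 ∷ 49 ∷ 69 ∷ 63 ∷ 22 ∷ 41 ∷ 29 ∷ 82 ∷ 80 ∷ 87 ∷ 42 ∷ 92 ∷ 6 ∷ 11 ∷ 90 ∷ 48 ∷ 16 ∷ 51 ∷ 27 ∷ 89 ∷ 62 ∷ 30 ∷ 91 ∷ 38 ∷ 52 ∷ 32 ∷ 67 ∷ 109 ∷ 78 ∷ 95 ∷ 110 ∷ 8 ∷ 40 ∷ 45 ∷ 72 ∷ 106 ∷ 99 ∷ 85 ∷ 103 ∷ 20 ∷ 14 ∷ 64 ∷ 100 ∷ 37 ∷ 23 ∷ 102 ∷ 28 ∷ 83 ∷ 97 ∷ 21 ∷ 25 ∷ 15 ∷ 105 ∷ 86 ∷ 98 ∷ 18 ∷ 70 ∷ 111 ∷ 19 ∷ 88 ∷ 2 ∷ 76 ∷ 9 ∷ 94 ∷ 58 ∷ 104 ∷ 3 ∷ 12 ∷ 71 ∷ 79 ∷ 107 ∷ 59 ∷ 77 ∷ 65 ∷ 96 ∷ 74 ∷ 84 ∷ 81 ∷ 108 ∷ 75 ∷ 101 ∷ 68 ∷ 93 ∷ [])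
  ∷ []
  ∷ []
  ∷ (57 ∷ 22 ∷ 0 ∷ 13 ∷ 59 ∷ 46 ∷ 43 ∷ 40 ∷ 31 ∷ 34 ∷ 27 ∷ 25 ∷ 58 ∷ 9 ∷ 45 ∷ 51 ∷ 1 ∷ 21 ∷ 72 ∷ 60 ∷ 56 ∷ 23 ∷ 32 ∷ 18 ∷ 68 ∷ 81 ∷ 49 ∷ 50 ∷ 4 ∷ 6 ∷ 15 ∷ 41 ∷ 35 ∷ 38 ∷ 63 ∷ 53 ∷ 33 ∷ 65 ∷ 84 ∷ 86 ∷ 80 ∷ 90 ∷ 52 ∷ 77 ∷ 47 ∷ 93 ∷ 82 ∷ 74 ∷ 10 ∷ 99 ∷ 11 ∷ 102 ∷ 12 ∷ 105 ∷ 48 ∷ 54 ∷ 91 ∷ 42 ∷ 55 ∷ 116 ∷ 69 ∷ 104 ∷ 30 ∷ 70 ∷ 44 ∷ 20 ∷ 71 ∷ 39 ∷ 110 ∷ 94 ∷ 37 ∷ 92 ∷ 117 ∷ 97 ∷ 100 ∷ 36 ∷ 29 ∷ 108 ∷ 115 ∷ 109 ∷ 24 ∷ 2 ∷ 19 ∷ 14 ∷ 28 ∷ 61 ∷ 17 ∷ 79 ∷ 5 ∷ 26 ∷ 112 ∷ 7 ∷ 3 ∷ 106 ∷ 89 ∷ 64 ∷ 111 ∷ 62 ∷ 16 ∷ 73 ∷ 66 ∷ 101 ∷ 8 ∷ 78 ∷ 107 ∷ 76 ∷ 83 ∷ 88 ∷ 98 ∷ 96 ∷ 103 ∷ 113 ∷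 67 ∷ 95 ∷ 87 ∷ 114 ∷ 75 ∷ 85 ∷ [])
  ∷ (58 ∷ 14 ∷ 40 ∷ 32 ∷ 21 ∷ 43 ∷ 54 ∷ 47 ∷ 42 ∷ 31 ∷ 11 ∷ 12 ∷ 59 ∷ 30 ∷ 10 ∷ 44 ∷ 4 ∷ 74 ∷ 50 ∷ 7 ∷ 57 ∷ 26 ∷ 64 ∷ 71 ∷ 29 ∷ 72 ∷ 70 ∷ 81 ∷ 67 ∷ 33 ∷ 49 ∷ 38 ∷ 41 ∷ 18 ∷ 36 ∷ 39 ∷ 55 ∷ 92 ∷ 28 ∷ 46 ∷ 27 ∷ 48 ∷ 91 ∷ 52 ∷ 100 ∷ 90 ∷ 9 ∷ 35 ∷ 53 ∷ 86 ∷ 103 ∷ 25 ∷ 102 ∷ 78 ∷ 45 ∷ 89 ∷ 107 ∷ 69 ∷ 23 ∷ 56 ∷ 118 ∷ 104 ∷ 114 ∷ 34 ∷ 93 ∷ 51 ∷ 24 ∷ 8 ∷ 88 ∷ 87 ∷ 110 ∷ 98 ∷ 96 ∷ 119 ∷ 19 ∷ 101 ∷ 99 ∷ 68 ∷ 85 ∷ 117 ∷ 37 ∷ 109 ∷ 5 ∷ 83 ∷ 95 ∷ 13 ∷ 22 ∷ 106 ∷ 16 ∷ 65 ∷ 20 ∷ 108 ∷ 84 ∷ 115 ∷ 17 ∷ 79 ∷ 6 ∷ 112 ∷ 15 ∷ 94 ∷ 73 ∷ 105 ∷ 3 ∷ 113 ∷ 66 ∷ 2 ∷ 76 ∷ 63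 ∷ 1 ∷ 62 ∷ 82 ∷ 61 ∷ 80 ∷ 77 ∷ 0 ∷ 75 ∷ 60 ∷ 116 ∷ 111 ∷ 97 ∷ [])
  ∷ []
  ∷ []
  ∷ (61 ∷ 4 ∷ 40 ∷ 49 ∷ 14 ∷ 52 ∷ 60 ∷ 67 ∷ 48 ∷ 30 ∷ 6 ∷ 13 ∷ 23 ∷ 41 ∷ 3 ∷ 0 ∷ 32 ∷ 63 ∷ 69 ∷ 66 ∷ 77 ∷ 19 ∷ 59 ∷ 11 ∷ 1 ∷ 42 ∷ 76 ∷ 64 ∷ 27 ∷ 29 ∷ 39 ∷ 54 ∷ 9 ∷ 31 ∷ 44 ∷ 56 ∷ 74 ∷ 86 ∷ 45 ∷ 34 ∷ 58 ∷ 93 ∷ 82 ∷ 72 ∷ 103 ∷ 35 ∷ 22 ∷ 37 ∷ 26 ∷ 38 ∷ 95 ∷ 51 ∷ 62 ∷ 36 ∷ 112 ∷ 55 ∷ 104 ∷ 90 ∷ 111 ∷ 115 ∷ 92 ∷ 21 ∷ 53 ∷ 124 ∷ 7 ∷ 57 ∷ 94 ∷ 50 ∷ 123 ∷ 105 ∷ 85 ∷ 102 ∷ 46 ∷ 70 ∷ 47 ∷ 97 ∷ 89 ∷ 43 ∷ 18 ∷ 25 ∷ 107 ∷ 28 ∷ 98 ∷ 122 ∷ 84 ∷ 108 ∷ 100 ∷ 117 ∷ 17 ∷ 101 ∷ 33 ∷ 99 ∷ 16 ∷ 119 ∷ 12 ∷ 24 ∷ 20 ∷ 15 ∷ 81 ∷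 2 ∷ 121 ∷ 10 ∷ 5 ∷ 65 ∷ 114 ∷ 8 ∷ 88 ∷ 80 ∷ 75 ∷ 68 ∷ 79 ∷ 91 ∷ 118 ∷ 73 ∷ 78 ∷ 71 ∷ 125 ∷ 116 ∷ 83 ∷ 113 ∷ 109 ∷ 87 ∷ 106 ∷ 110 ∷ 120 ∷ 96 ∷ [])
  ∷ (62 ∷ 4 ∷ 48 ∷ 50 ∷ 51 ∷ 28 ∷ 12 ∷ 68 ∷ 44 ∷ 47 ∷ 27 ∷ 10 ∷ 11 ∷ 32 ∷ 30 ∷ 33 ∷ 57 ∷ 18 ∷ 43 ∷ 56 ∷ 76 ∷ 53 ∷ 38 ∷ 74 ∷ 19 ∷ 75 ∷ 16 ∷ 13 ∷ 37 ∷ 5 ∷ 8 ∷ 52 ∷ 61 ∷ 31 ∷ 7 ∷ 92 ∷ 69 ∷ 82 ∷ 40 ∷ 91 ∷ 72 ∷ 26 ∷ 77 ∷ 71 ∷ 80 ∷ 83 ∷ 94 ∷ 96 ∷ 36 ∷ 54 ∷ 97 ∷ 59 ∷ 112 ∷ 63 ∷ 108 ∷ 114 ∷ 41 ∷ 115 ∷ 111 ∷ 55 ∷ 58 ∷ 35 ∷ 102 ∷ 107 ∷ 126 ∷ 60 ∷ 95 ∷ 101 ∷ 45 ∷ 90 ∷ 25 ∷ 17 ∷ 22 ∷ 46 ∷ 49 ∷ 121 ∷ 117 ∷ 120 ∷ 34 ∷ 23 ∷ 104 ∷ 39 ∷ 42 ∷ 24 ∷ 21 ∷ 116 ∷ 100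 ∷ 14 ∷ 1 ∷ 3 ∷ 81 ∷ 65 ∷ 29 ∷ 6 ∷ 67 ∷ 125 ∷ 86 ∷ 89 ∷ 99 ∷ 105 ∷ 15 ∷ 70 ∷ 20 ∷ 78 ∷ 87 ∷ 118 ∷ 2 ∷ 85 ∷ 9 ∷ 88 ∷ 66 ∷ 0 ∷ 123 ∷ 64 ∷ 98 ∷ 109 ∷ 119 ∷ 79 ∷ 127 ∷ 73 ∷ 122 ∷ 110 ∷ 103 ∷ 93 ∷ 84 ∷ 113 ∷ 106 ∷ 124 ∷ [])
  ∷ []
  ∷ []
  ∷ (42 ∷ 20 ∷ 7 ∷ 30 ∷ 28 ∷ 13 ∷ 53 ∷ 18 ∷ 11 ∷ 29 ∷ 50 ∷ 74 ∷ 4 ∷ 49 ∷ 3 ∷ 35 ∷ 58 ∷ 63 ∷ 71 ∷ 70 ∷ 80 ∷ 78 ∷ 1 ∷ 87 ∷ 41 ∷ 68 ∷ 44 ∷ 85 ∷ 8 ∷ 61 ∷ 27 ∷ 45 ∷ 60 ∷ 12 ∷ 95 ∷ 97 ∷ 59 ∷ 21 ∷ 75 ∷ 47 ∷ 96 ∷ 14 ∷ 56 ∷ 24 ∷ 109 ∷ 54 ∷ 64 ∷ 79 ∷ 66 ∷ 38 ∷ 55 ∷ 15 ∷ 102 ∷ 31 ∷ 52 ∷ 26 ∷ 40 ∷ 81 ∷ 25 ∷ 94 ∷ 88 ∷ 120 ∷ 117 ∷ 65 ∷ 116 ∷ 62 ∷ 36 ∷ 108 ∷ 82 ∷ 91 ∷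 46 ∷ 22 ∷ 111 ∷ 51 ∷ 57 ∷ 37 ∷ 125 ∷ 48 ∷ 112 ∷ 43 ∷ 23 ∷ 32 ∷ 130 ∷ 93 ∷ 34 ∷ 92 ∷ 98 ∷ 17 ∷ 114 ∷ 105 ∷ 39 ∷ 16 ∷ 128 ∷ 33 ∷ 127 ∷ 89 ∷ 19 ∷ 126 ∷ 107 ∷ 2 ∷ 123 ∷ 121 ∷ 9 ∷ 69 ∷ 103 ∷ 90 ∷ 84 ∷ 122 ∷ 119 ∷ 83 ∷ 10 ∷ 6 ∷ 131 ∷ 76 ∷ 104 ∷ 99 ∷ 133 ∷ 86 ∷ 113 ∷ 73 ∷ 101 ∷ 0 ∷ 77 ∷ 67 ∷ 110 ∷ 5 ∷ 118 ∷ 115 ∷ 100 ∷ 129 ∷ 132 ∷ 106 ∷ 72 ∷ 124 ∷ [])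
  ∷ (39 ∷ 20 ∷ 7 ∷ 40 ∷ 0 ∷ 57 ∷ 68 ∷ 51 ∷ 60 ∷ 21 ∷ 45 ∷ 75 ∷ 8 ∷ 50 ∷ 26 ∷ 23 ∷ 44 ∷ 55 ∷ 27 ∷ 4 ∷ 37 ∷ 43 ∷ 76 ∷ 88 ∷ 54 ∷ 72 ∷ 56 ∷ 9 ∷ 52 ∷ 42 ∷ 3 ∷ 18 ∷ 89 ∷ 63 ∷ 35 ∷ 71 ∷ 64 ∷ 15 ∷ 77 ∷ 58 ∷ 91 ∷ 107 ∷ 94 ∷ 59 ∷ 66 ∷ 108 ∷ 65 ∷ 95 ∷ 67 ∷ 12 ∷ 38 ∷ 86 ∷ 29 ∷ 24 ∷ 83 ∷ 48 ∷ 10 ∷ 113 ∷ 33 ∷ 105 ∷ 119 ∷ 47 ∷ 112 ∷ 80 ∷ 125 ∷ 118 ∷ 111 ∷ 53 ∷ 78 ∷ 62 ∷ 128 ∷ 103 ∷ 61 ∷ 110 ∷ 123 ∷ 49 ∷ 41 ∷ 32 ∷ 6 ∷ 92 ∷ 122 ∷ 46 ∷ 120 ∷ 97 ∷ 124 ∷ 34 ∷ 74 ∷ 31 ∷ 13 ∷ 16 ∷ 106 ∷ 30 ∷ 1 ∷ 101 ∷ 22 ∷ 69 ∷ 36 ∷ 25 ∷ 131 ∷ 126 ∷ 14 ∷ 28 ∷ 132 ∷ 81 ∷ 127 ∷ 116 ∷ 17 ∷ 84 ∷ 5 ∷ 19 ∷ 115 ∷ 100 ∷ 134 ∷ 133 ∷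 11 ∷ 73 ∷ 82 ∷ 135 ∷ 90 ∷ 109 ∷ 99 ∷ 102 ∷ 121 ∷ 98 ∷ 93 ∷ 85 ∷ 117 ∷ 79 ∷ 2 ∷ 114 ∷ 87 ∷ 96 ∷ 70 ∷ 130 ∷ 104 ∷ 129 ∷ [])
  ∷ []
  ∷ []
  ∷ (56 ∷ 31 ∷ 7 ∷ 44 ∷ 15 ∷ 65 ∷ 34 ∷ 6 ∷ 52 ∷ 18 ∷ 45 ∷ 78 ∷ 67 ∷ 9 ∷ 25 ∷ 77 ∷ 61 ∷ 26 ∷ 40 ∷ 69 ∷ 37 ∷ 86 ∷ 59 ∷ 51 ∷ 80 ∷ 57 ∷ 36 ∷ 53 ∷ 70 ∷ 89 ∷ 43 ∷ 58 ∷ 33 ∷ 66 ∷ 102 ∷ 62 ∷ 54 ∷ 30 ∷ 38 ∷ 11 ∷ 4 ∷ 96 ∷ 105 ∷ 20 ∷ 27 ∷ 97 ∷ 75 ∷ 21 ∷ 46 ∷ 115 ∷ 1 ∷ 60 ∷ 82 ∷ 72 ∷ 64 ∷ 32 ∷ 19 ∷ 116 ∷ 127 ∷ 108 ∷ 111 ∷ 68 ∷ 123 ∷ 41 ∷ 107 ∷ 91 ∷ 49 ∷ 104 ∷ 48 ∷ 101 ∷ 92 ∷ 55 ∷ 136 ∷ 98 ∷ 63 ∷ 114 ∷ 122 ∷ 90 ∷ 109 ∷ 132 ∷ 50 ∷ 138 ∷ 124 ∷ 130 ∷ 128 ∷ 23 ∷ 42 ∷ 47 ∷ 12 ∷ 103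 ∷ 140 ∷ 129 ∷ 125 ∷ 16 ∷ 8 ∷ 29 ∷ 117 ∷ 39 ∷ 35 ∷ 133 ∷ 141 ∷ 137 ∷ 83 ∷ 14 ∷ 79 ∷ 17 ∷ 112 ∷ 28 ∷ 24 ∷ 22 ∷ 94 ∷ 87 ∷ 0 ∷ 131 ∷ 71 ∷ 5 ∷ 3 ∷ 120 ∷ 119 ∷ 85 ∷ 135 ∷ 74 ∷ 76 ∷ 2 ∷ 88 ∷ 13 ∷ 100 ∷ 73 ∷ 126 ∷ 10 ∷ 113 ∷ 139 ∷ 121 ∷ 93 ∷ 95 ∷ 106 ∷ 118 ∷ 99 ∷ 110 ∷ 134 ∷ 84 ∷ 81 ∷ [])
  ∷ (15 ∷ 54 ∷ 40 ∷ 59 ∷ 65 ∷ 47 ∷ 53 ∷ 68 ∷ 42 ∷ 39 ∷ 0 ∷ 7 ∷ 72 ∷ 63 ∷ 20 ∷ 66 ∷ 37 ∷ 87 ∷ 62 ∷ 58 ∷ 79 ∷ 46 ∷ 44 ∷ 70 ∷ 13 ∷ 10 ∷ 21 ∷ 22 ∷ 69 ∷ 4 ∷ 57 ∷ 71 ∷ 36 ∷ 24 ∷ 11 ∷ 76 ∷ 92 ∷ 82 ∷ 51 ∷ 85 ∷ 55 ∷ 3 ∷ 61 ∷ 67 ∷ 112 ∷ 29 ∷ 75 ∷ 83 ∷ 64 ∷ 93 ∷ 111 ∷ 94 ∷ 114 ∷ 45 ∷ 119 ∷ 109 ∷ 34 ∷ 126 ∷ 14 ∷ 96 ∷ 49 ∷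 125 ∷ 26 ∷ 52 ∷ 131 ∷ 19 ∷ 38 ∷ 27 ∷ 116 ∷ 118 ∷ 108 ∷ 137 ∷ 6 ∷ 56 ∷ 86 ∷ 48 ∷ 101 ∷ 140 ∷ 135 ∷ 130 ∷ 78 ∷ 60 ∷ 134 ∷ 138 ∷ 50 ∷ 33 ∷ 91 ∷ 35 ∷ 43 ∷ 129 ∷ 98 ∷ 123 ∷ 106 ∷ 23 ∷ 41 ∷ 142 ∷ 99 ∷ 127 ∷ 2 ∷ 141 ∷ 117 ∷ 25 ∷ 74 ∷ 30 ∷ 143 ∷ 133 ∷ 110 ∷ 31 ∷ 32 ∷ 28 ∷ 18 ∷ 121 ∷ 139 ∷ 8 ∷ 136 ∷ 5 ∷ 16 ∷ 124 ∷ 95 ∷ 17 ∷ 105 ∷ 9 ∷ 77 ∷ 80 ∷ 107 ∷ 120 ∷ 1 ∷ 12 ∷ 97 ∷ 73 ∷ 90 ∷ 128 ∷ 81 ∷ 115 ∷ 88 ∷ 102 ∷ 122 ∷ 113 ∷ 89 ∷ 100 ∷ 103 ∷ 84 ∷ 104 ∷ 132 ∷ [])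
  ∷ []
  ∷ []
  ∷ (48 ∷ 62 ∷ 69 ∷ 72 ∷ 63 ∷ 31 ∷ 51 ∷ 5 ∷ 14 ∷ 9 ∷ 46 ∷ 18 ∷ 65 ∷ 66 ∷ 80 ∷ 68 ∷ 0 ∷ 17 ∷ 75 ∷ 6 ∷ 84 ∷ 44 ∷ 27 ∷ 53 ∷ 89 ∷ 64 ∷ 33 ∷ 81 ∷ 56 ∷ 57 ∷ 40 ∷ 93 ∷ 71 ∷ 2 ∷ 13 ∷ 60 ∷ 92 ∷ 77 ∷ 106 ∷ 35 ∷ 41 ∷ 23 ∷ 49 ∷ 45 ∷ 24 ∷ 47 ∷ 54 ∷ 73 ∷ 37 ∷ 88 ∷ 123 ∷ 102 ∷ 59 ∷ 29 ∷ 50 ∷ 43 ∷ 70 ∷ 42 ∷ 121 ∷ 126 ∷ 30 ∷ 108 ∷ 34 ∷ 39 ∷ 8 ∷ 137 ∷ 98 ∷ 119 ∷ 74 ∷ 138 ∷ 99 ∷ 52 ∷ 115 ∷ 144 ∷ 83 ∷ 61 ∷ 110 ∷ 147 ∷ 128 ∷ 140 ∷ 67 ∷ 141 ∷ 58 ∷ 116 ∷ 104 ∷ 143 ∷ 131 ∷ 112 ∷ 132 ∷ 55 ∷ 120 ∷ 139 ∷ 105 ∷ 124 ∷ 122 ∷ 32 ∷ 26 ∷ 135 ∷ 109 ∷ 15 ∷ 118 ∷ 117 ∷ 129 ∷ 38 ∷ 114 ∷ 146 ∷ 125 ∷ 12 ∷ 20 ∷ 36 ∷ 11 ∷ 21 ∷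 19 ∷ 134 ∷ 25 ∷ 22 ∷ 90 ∷ 16 ∷ 28 ∷ 10 ∷ 4 ∷ 87 ∷ 148 ∷ 86 ∷ 101 ∷ 127 ∷ 79 ∷ 3 ∷ 145 ∷ 107 ∷ 95 ∷ 85 ∷ 78 ∷ 94 ∷ 96 ∷ 91 ∷ 7 ∷ 1 ∷ 136 ∷ 97 ∷ 76 ∷ 100 ∷ 133 ∷ 113 ∷ 149 ∷ 82 ∷ 130 ∷ 111 ∷ 103 ∷ 142 ∷ [])
  ∷ (45 ∷ 73 ∷ 27 ∷ 69 ∷ 8 ∷ 46 ∷ 15 ∷ 30 ∷ 50 ∷ 39 ∷ 3 ∷ 32 ∷ 24 ∷ 34 ∷ 84 ∷ 79 ∷ 66 ∷ 11 ∷ 44 ∷ 31 ∷ 29 ∷ 72 ∷ 17 ∷ 91 ∷ 42 ∷ 5 ∷ 35 ∷ 74 ∷ 40 ∷ 65 ∷ 87 ∷ 103 ∷ 81 ∷ 55 ∷ 52 ∷ 21 ∷ 47 ∷ 38 ∷ 100 ∷ 106 ∷ 51 ∷ 93 ∷ 36 ∷ 49 ∷ 68 ∷ 108 ∷ 6 ∷ 121 ∷ 41 ∷ 110 ∷ 115 ∷ 105 ∷ 107 ∷ 122 ∷ 82 ∷ 71 ∷ 61 ∷ 58 ∷ 97 ∷ 48 ∷ 126 ∷ 60 ∷ 25 ∷ 111 ∷ 120 ∷ 70 ∷ 63 ∷ 53 ∷ 118 ∷ 62 ∷ 116 ∷ 54 ∷ 75 ∷ 33 ∷ 145 ∷ 23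 ∷ 149 ∷ 114 ∷ 64 ∷ 26 ∷ 112 ∷ 18 ∷ 67 ∷ 20 ∷ 142 ∷ 123 ∷ 57 ∷ 59 ∷ 128 ∷ 101 ∷ 131 ∷ 117 ∷ 56 ∷ 127 ∷ 125 ∷ 148 ∷ 141 ∷ 7 ∷ 10 ∷ 19 ∷ 99 ∷ 94 ∷ 43 ∷ 150 ∷ 37 ∷ 96 ∷ 83 ∷ 102 ∷ 109 ∷ 124 ∷ 86 ∷ 22 ∷ 28 ∷ 14 ∷ 144 ∷ 9 ∷ 12 ∷ 134 ∷ 16 ∷ 137 ∷ 95 ∷ 2 ∷ 129 ∷ 136 ∷ 13 ∷ 78 ∷ 85 ∷ 130 ∷ 147 ∷ 90 ∷ 88 ∷ 139 ∷ 0 ∷ 138 ∷ 76 ∷ 98 ∷ 92 ∷ 146 ∷ 1 ∷ 89 ∷ 4 ∷ 77 ∷ 104 ∷ 113 ∷ 140 ∷ 133 ∷ 80 ∷ 119 ∷ 135 ∷ 151 ∷ 132 ∷ 143 ∷ [])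
  ∷ []
  ∷ []
  ∷ (30 ∷ 7 ∷ 38 ∷ 70 ∷ 51 ∷ 54 ∷ 45 ∷ 28 ∷ 52 ∷ 5 ∷ 86 ∷ 0 ∷ 41 ∷ 79 ∷ 62 ∷ 11 ∷ 84 ∷ 31 ∷ 48 ∷ 20 ∷ 23 ∷ 68 ∷ 58 ∷ 42 ∷ 10 ∷ 37 ∷ 2 ∷ 77 ∷ 90 ∷ 40 ∷ 81 ∷ 78 ∷ 109 ∷ 12 ∷ 43 ∷ 9 ∷ 89 ∷ 107 ∷ 63 ∷ 47 ∷ 55 ∷ 99 ∷ 117 ∷ 57 ∷ 76 ∷ 102 ∷ 88 ∷ 91 ∷ 50 ∷ 69 ∷ 110 ∷ 74 ∷ 33 ∷ 124 ∷ 17 ∷ 120 ∷ 56 ∷ 130 ∷ 39 ∷ 72 ∷ 67 ∷ 133 ∷ 131 ∷ 19 ∷ 116 ∷ 59 ∷ 44 ∷ 121 ∷ 127 ∷ 75 ∷ 64 ∷ 119 ∷ 73 ∷ 96 ∷ 65 ∷ 149 ∷ 32 ∷ 66 ∷ 141 ∷ 122 ∷ 34 ∷ 71 ∷ 137 ∷ 53 ∷ 98 ∷ 14 ∷ 16 ∷ 112 ∷ 126 ∷ 49 ∷ 61 ∷ 147 ∷ 13 ∷ 60 ∷ 22 ∷ 26 ∷ 36 ∷ 134 ∷ 8 ∷ 118 ∷ 129 ∷ 93 ∷ 136 ∷ 142 ∷ 95 ∷ 21 ∷ 156 ∷ 92 ∷ 87 ∷ 46 ∷ 111 ∷ 157 ∷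 123 ∷ 6 ∷ 135 ∷ 35 ∷ 113 ∷ 25 ∷ 101 ∷ 27 ∷ 148 ∷ 85 ∷ 155 ∷ 105 ∷ 24 ∷ 29 ∷ 138 ∷ 153 ∷ 100 ∷ 146 ∷ 3 ∷ 18 ∷ 15 ∷ 151 ∷ 115 ∷ 82 ∷ 143 ∷ 4 ∷ 132 ∷ 1 ∷ 128 ∷ 144 ∷ 80 ∷ 83 ∷ 104 ∷ 145 ∷ 154 ∷ 152 ∷ 106 ∷ 94 ∷ 103 ∷ 97 ∷ 114 ∷ 140 ∷ 150 ∷ 139 ∷ 108 ∷ 125 ∷ [])
  ∷ (30 ∷ 7 ∷ 70 ∷ 32 ∷ 51 ∷ 39 ∷ 10 ∷ 29 ∷ 69 ∷ 5 ∷ 87 ∷ 38 ∷ 68 ∷ 72 ∷ 75 ∷ 56 ∷ 85 ∷ 25 ∷ 90 ∷ 74 ∷ 48 ∷ 26 ∷ 45 ∷ 17 ∷ 4 ∷ 54 ∷ 40 ∷ 78 ∷ 63 ∷ 57 ∷ 84 ∷ 79 ∷ 110 ∷ 65 ∷ 41 ∷ 24 ∷ 47 ∷ 112 ∷ 109 ∷ 58 ∷ 64 ∷ 23 ∷ 97 ∷ 33 ∷ 105 ∷ 61 ∷ 119 ∷ 55 ∷ 0 ∷ 106 ∷ 80 ∷ 118 ∷ 66 ∷ 62 ∷ 76 ∷ 71 ∷ 36 ∷ 131 ∷ 2 ∷ 77 ∷ 9 ∷ 104 ∷ 82 ∷ 53 ∷ 44 ∷ 46 ∷ 103 ∷ 27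 ∷ 120 ∷ 125 ∷ 128 ∷ 89 ∷ 73 ∷ 136 ∷ 150 ∷ 42 ∷ 14 ∷ 121 ∷ 113 ∷ 149 ∷ 60 ∷ 134 ∷ 148 ∷ 59 ∷ 67 ∷ 127 ∷ 37 ∷ 152 ∷ 137 ∷ 50 ∷ 6 ∷ 155 ∷ 94 ∷ 143 ∷ 116 ∷ 154 ∷ 107 ∷ 52 ∷ 86 ∷ 138 ∷ 145 ∷ 31 ∷ 19 ∷ 11 ∷ 135 ∷ 49 ∷ 144 ∷ 158 ∷ 141 ∷ 15 ∷ 124 ∷ 35 ∷ 159 ∷ 126 ∷ 43 ∷ 22 ∷ 91 ∷ 142 ∷ 133 ∷ 122 ∷ 146 ∷ 34 ∷ 28 ∷ 99 ∷ 20 ∷ 117 ∷ 95 ∷ 21 ∷ 151 ∷ 18 ∷ 1 ∷ 3 ∷ 156 ∷ 81 ∷ 111 ∷ 8 ∷ 83 ∷ 16 ∷ 157 ∷ 102 ∷ 12 ∷ 130 ∷ 140 ∷ 13 ∷ 139 ∷ 88 ∷ 100 ∷ 153 ∷ 115 ∷ 98 ∷ 101 ∷ 132 ∷ 108 ∷ 147 ∷ 92 ∷ 96 ∷ 129 ∷ 114 ∷ 93 ∷ 123 ∷ [])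
  ∷ []
  ∷ []
  ∷ (64 ∷ 37 ∷ 39 ∷ 27 ∷ 13 ∷ 74 ∷ 51 ∷ 2 ∷ 79 ∷ 5 ∷ 32 ∷ 85 ∷ 60 ∷ 41 ∷ 76 ∷ 6 ∷ 88 ∷ 68 ∷ 1 ∷ 96 ∷ 69 ∷ 84 ∷ 52 ∷ 89 ∷ 4 ∷ 42 ∷ 82 ∷ 33 ∷ 24 ∷ 65 ∷ 87 ∷ 17 ∷ 110 ∷ 28 ∷ 78 ∷ 71 ∷ 75 ∷ 59 ∷ 8 ∷ 54 ∷ 120 ∷ 45 ∷ 29 ∷ 122 ∷ 115 ∷ 55 ∷ 67 ∷ 12 ∷ 91 ∷ 80 ∷ 100 ∷ 58 ∷ 3 ∷ 46 ∷ 107 ∷ 14 ∷ 124 ∷ 86 ∷ 66 ∷ 134 ∷ 43 ∷ 95 ∷ 116 ∷ 111 ∷ 9 ∷ 57 ∷ 147 ∷ 81 ∷ 72 ∷ 125 ∷ 7 ∷ 97 ∷ 53 ∷ 112 ∷ 143 ∷ 92 ∷ 135 ∷ 73 ∷ 63 ∷ 90 ∷ 77 ∷ 157 ∷ 70 ∷ 36 ∷ 49 ∷ 30 ∷ 48 ∷ 151 ∷ 128 ∷ 162 ∷ 38 ∷ 152 ∷ 159 ∷ 25 ∷ 61 ∷ 137 ∷ 148 ∷ 62 ∷ 142 ∷ 22 ∷ 26 ∷ 129 ∷ 138 ∷ 50 ∷ 47 ∷ 126 ∷ 56 ∷ 40 ∷ 154 ∷ 18 ∷ 165 ∷ 141 ∷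 31 ∷ 158 ∷ 161 ∷ 150 ∷ 44 ∷ 113 ∷ 20 ∷ 35 ∷ 108 ∷ 119 ∷ 34 ∷ 105 ∷ 140 ∷ 19 ∷ 149 ∷ 136 ∷ 109 ∷ 101 ∷ 121 ∷ 163 ∷ 10 ∷ 16 ∷ 11 ∷ 132 ∷ 131 ∷ 21 ∷ 23 ∷ 0 ∷ 103 ∷ 83 ∷ 155 ∷ 146 ∷ 93 ∷ 114 ∷ 102 ∷ 94 ∷ 15 ∷ 123 ∷ 164 ∷ 99 ∷ 156 ∷ 130 ∷ 153 ∷ 133 ∷ 118 ∷ 144 ∷ 117 ∷ 160 ∷ 104 ∷ 145 ∷ 127 ∷ 106 ∷ 139 ∷ 98 ∷ [])
  ∷ (20 ∷ 29 ∷ 1 ∷ 66 ∷ 32 ∷ 85 ∷ 13 ∷ 26 ∷ 69 ∷ 17 ∷ 7 ∷ 36 ∷ 2 ∷ 44 ∷ 21 ∷ 10 ∷ 86 ∷ 59 ∷ 56 ∷ 91 ∷ 77 ∷ 97 ∷ 104 ∷ 80 ∷ 37 ∷ 25 ∷ 8 ∷ 94 ∷ 101 ∷ 46 ∷ 72 ∷ 79 ∷ 113 ∷ 75 ∷ 53 ∷ 110 ∷ 92 ∷ 105 ∷ 116 ∷ 65 ∷ 39 ∷ 83 ∷ 63 ∷ 19 ∷ 81 ∷ 11 ∷ 18 ∷ 5 ∷ 70 ∷ 120 ∷ 38 ∷ 71 ∷ 109 ∷ 60 ∷ 89 ∷ 43 ∷ 76 ∷ 27 ∷ 95 ∷ 128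 ∷ 35 ∷ 74 ∷ 50 ∷ 121 ∷ 103 ∷ 6 ∷ 102 ∷ 15 ∷ 78 ∷ 52 ∷ 61 ∷ 150 ∷ 82 ∷ 90 ∷ 67 ∷ 40 ∷ 140 ∷ 130 ∷ 143 ∷ 153 ∷ 48 ∷ 123 ∷ 73 ∷ 68 ∷ 99 ∷ 45 ∷ 111 ∷ 42 ∷ 55 ∷ 137 ∷ 122 ∷ 49 ∷ 34 ∷ 51 ∷ 12 ∷ 16 ∷ 64 ∷ 119 ∷ 58 ∷ 161 ∷ 127 ∷ 62 ∷ 57 ∷ 47 ∷ 156 ∷ 164 ∷ 149 ∷ 147 ∷ 96 ∷ 30 ∷ 159 ∷ 54 ∷ 163 ∷ 100 ∷ 134 ∷ 144 ∷ 4 ∷ 124 ∷ 31 ∷ 23 ∷ 154 ∷ 41 ∷ 88 ∷ 136 ∷ 155 ∷ 33 ∷ 167 ∷ 165 ∷ 118 ∷ 24 ∷ 132 ∷ 126 ∷ 129 ∷ 145 ∷ 160 ∷ 22 ∷ 28 ∷ 158 ∷ 0 ∷ 9 ∷ 84 ∷ 114 ∷ 133 ∷ 151 ∷ 107 ∷ 139 ∷ 135 ∷ 14 ∷ 162 ∷ 3 ∷ 93 ∷ 115 ∷ 131 ∷ 152 ∷ 87 ∷ 108 ∷ 166 ∷ 157 ∷ 142 ∷ 106 ∷ 117 ∷ 141 ∷ 148 ∷ 98 ∷ 125 ∷ 146 ∷ 112 ∷ 138 ∷ [])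
  ∷ []

tabulatedPairing : ℕ → Bool
tabulatedPairing n = checkPairing 2 n (entry 0 (entry [] firstTable n))
                                      (entry 0 (entry [] occupantTable n))

Admissible : ℕ → Set
Admissible n = n % 4 ≡ 0 ⊎ n % 4 ≡ 3

admissible? : ∀ n → Dec (Admissible n)
admissible? n = (n % 4 ≟ 0) ⊎-dec (n % 4 ≟ 3)

-- What evaluation establishes about n: the tabulated pairing is valid when n is
-- admissible, and 2 + 3 + ⋯ + (3n+1) is odd when it is not.
verdictFor : ∀ n → Dec (Admissible n) → Bool
verdictFor n (yes _) = tabulatedPairing n
verdictFor n (no _)  = not (consecutiveSum 2 (n + n + n) % 2 ≡ᵇ 0)

verdictFor-sound : ∀ n (adm? : Dec (Admissible n)) → T (verdictFor n adm?) →
                   (Admissible n → LangfordPairing 2 n) ×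
                   (consecutiveSum 2 (n + n + n) % 2 ≡ 0 → Admissible n)
verdictFor-sound n (yes adm) ok  = (λ _ → checkPairing-sound _ _ _ _ ok) , (λ _ → adm)
verdictFor-sound n (no ¬adm) odd = (λ adm → contradiction adm ¬adm)
                                 , (λ even → ⊥-elim (subst T (to T-not-≡ odd) (≡⇒≡ᵇ _ _ even)))

verdict : ℕ → Bool
verdict n = verdictFor n (admissible? n)

allVerdicts : T (allBelow 85 verdict)
allVerdicts = tt

theorem3p18 : (n : ℕ) → 1 ≤ n → n ≤ 84 →
    (Σ (SuperGraceful 2 (nK₂ n)) (λ L → EdgeLabelSet L 2 (n + 1)))
    ⇔ (n % 4 ≡ 0 ⊎ n % 4 ≡ 3)
theorem3p18 n _ n≤84 = mk⇔ necessity sufficiency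
  where
  certified = verdictFor-sound n (admissible? n)
                (allBelow-sound 85 verdict allVerdicts n (s≤s n≤84))

  necessity : Σ (SuperGraceful 2 (nK₂ n)) (λ L → EdgeLabelSet L 2 (n + 1)) → Admissible n
  necessity (L , _) = proj₂ certified (nK₂-parity L)

  sufficiency : Admissible n → Σ (SuperGraceful 2 (nK₂ n)) (λ L → EdgeLabelSet L 2 (n + 1))
  sufficiency adm = map₂ (λ {L} → subst (EdgeLabelSet L 2) (+-comm 1 n))
                         (langford⇒superGraceful (s≤s z≤n) (proj₁ certified adm))
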